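{- Let $G=(A\cup B,E)$ be a bipartite graph in which every node has a strict ranking of its neighbors. Let $M$ be a popular max-matching in $G$, let $U$ be the set of nodes left unmatched by $M$, $U_A=U\cap A$, $U_B=U\cap B$, $A'=A\setminus U$, $B'=B\setminus U$, and $n_0=|A'|=|B'|$. Let $E'$ be the edge set of the subgraph of $G$ induced on $(A\cup B)\setminus U$, and consider the linear program $$\min\sum_{u\in (A\cup B)\setminus U} y_u\quad\text{s.t.}\quad y_a+y_b\ge\mathsf{wt}_M(a,b)\ \ \forall (a,b)\in E'.$$ There exists an optimal solution $\vec\alpha$ of this program with $\alpha_a\in\{0,-2,\ldots,-2(n_0-1)\}$ for all $a\in A'$ and $\alpha_b\in\{0,2,\ldots,2(n_0-1)\}$ for all $b\in B'$ such that (i) $\alpha_a=0$ for all $a\in\mathsf{Nbr}(U_B)$ and (ii) $\alpha_b=2(n_0-1)$ for all $b\in\mathsf{Nbr}(U_A)$.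
   Context: Node $u$ prefers matching $M$ to $N$ if $u$ is matched in $M$ and unmatched in $N$, or matched in both and prefers its partner in $M$. $\phi(M,N)$ is the number of nodes preferring $M$ to $N$, $\Delta(M,N)=\phi(M,N)-\phi(N,M)$. A maximum matching $M$ is a popular max-matching if $\Delta(M,N)\ge0$ for all maximum matchings $N$ of $G$. An edge $(a,b)$ blocks $M$ if each of $a,b$ is unmatched in $M$ or prefers the other to its partner in $M$. $\mathsf{wt}_M(a,b)=2$ if $(a,b)$ blocks $M$; $-2$ if $a$ and $b$ both prefer their assignments in $M$ to each other; $0$ otherwise. For $T\subseteq A\cup B$, $\mathsf{Nbr}(T)$ is the set of neighbors in $G$ of nodes in $T$.
   Formalization: The linear program is taken over the rationals: the solution $\vec\alpha$ and every feasible solution it is compared against take rational values. -}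

module Defs where

open import Data.Nat using (ℕ; zero; suc; _<_; _<ᵇ_; _≤_; _*_)
import Data.Nat as ℕ
open import Data.Fin using (Fin; zero; suc)
open import Data.Bool using (Bool; true; false; if_then_else_; _∧_)
open import Data.Maybe using (Maybe; just; nothing)
open import Data.Product using (Σ; ∃; _×_; _,_)
open import Data.Integer using (ℤ; +_)
open import Data.Rational using (ℚ; 0ℚ; _/_) renaming (_+_ to _+ℚ_; _≤_ to _≤ℚ_; -_ to -ℚ_)
open import Relation.Binary.PropositionalEquality using (_≡_; _≢_)

count : ∀ {k} → (Fin k → Bool) → ℕ
count {zero}  f = 0
count {suc k} f = (if f zero then 1 else 0) ℕ.+ count (λ i → f (suc i))

sumℚ : ∀ {k} → (Fin k → ℚ) → ℚ
sumℚ {zero}  f = 0ℚ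
sumℚ {suc k} f = f zero +ℚ sumℚ (λ i → f (suc i))

isJust : ∀ {X : Set} → Maybe X → Bool
isJust (just _) = true
isJust nothing  = false

-- Bipartite graph A = Fin m, B = Fin n with strict rankings.
-- rankA a b : rank of b in a's list (smaller = more preferred), likewise rankB.

record PrefGraph (m n : ℕ) : Set where
  field
    E     : Fin m → Fin n → Bool
    rankA : Fin m → Fin n → ℕ
    rankB : Fin n → Fin m → ℕ
    strictA : ∀ a b b' → E a b ≡ true → E a b' ≡ true → rankA a b ≡ rankA a b' → b ≡ b'
    strictB : ∀ b a a' → E a b ≡ true → E a' b ≡ true → rankB b a ≡ rankB b a' → a ≡ a'

module _ {m n : ℕ} (G : PrefGraph m n) where
  open PrefGraph G

  record Matching : Set where
    field
      mateA : Fin m → Maybe (Fin n)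
      mateB : Fin n → Maybe (Fin m)
      consAB : ∀ a b → mateA a ≡ just b → mateB b ≡ just a
      consBA : ∀ a b → mateB b ≡ just a → mateA a ≡ just b
      inE    : ∀ a b → mateA a ≡ just b → E a b ≡ true
  open Matching public

  size : Matching → ℕ
  size M = count (λ a → isJust (mateA M a))

  IsMaximum : Matching → Set
  IsMaximum M = ∀ (N : Matching) → size N ≤ size M

  prefOptA : Fin m → Maybe (Fin n) → Maybe (Fin n) → Bool
  prefOptA a (just b) nothing   = true
  prefOptA a (just b) (just b') = rankA a b <ᵇ rankA a b'
  prefOptA a nothing  _         = false

  prefOptB : Fin n → Maybe (Fin m) → Maybe (Fin m) → Bool
  prefOptB b (just a) nothing   = true
  prefOptB b (just a) (just a') = rankB b a <ᵇ rankB b a'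
  prefOptB b nothing  _         = false

  φ : Matching → Matching → ℕ
  φ M N = count (λ a → prefOptA a (mateA M a) (mateA N a))
          ℕ.+ count (λ b → prefOptB b (mateB M b) (mateB N b))

  IsPopularMaxMatching : Matching → Set
  IsPopularMaxMatching M =
    IsMaximum M × (∀ (N : Matching) → IsMaximum N → φ N M ≤ φ M N)

  aPrefersOther : Matching → Fin m → Fin n → Bool
  aPrefersOther M a b with mateA M a
  ... | nothing = true
  ... | just b0 = rankA a b <ᵇ rankA a b0

  aPrefersOwn : Matching → Fin m → Fin n → Bool
  aPrefersOwn M a b with mateA M a
  ... | nothing = false
  ... | just b0 = rankA a b0 <ᵇ rankA a b

  bPrefersOther : Matching → Fin n → Fin m → Bool
  bPrefersOther M b a with mateB M b
  ... | nothing = true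
  ... | just a0 = rankB b a <ᵇ rankB b a0

  bPrefersOwn : Matching → Fin n → Fin m → Bool
  bPrefersOwn M b a with mateB M b
  ... | nothing = false
  ... | just a0 = rankB b a0 <ᵇ rankB b a

  two : ℚ
  two = + 2 / 1

  wt : Matching → Fin m → Fin n → ℚ
  wt M a b =
    if aPrefersOther M a b ∧ bPrefersOther M b a then two
    else if aPrefersOwn M a b ∧ bPrefersOwn M b a then -ℚ two
    else 0ℚ

  MatchedA : Matching → Fin m → Set
  MatchedA M a = isJust (mateA M a) ≡ true

  MatchedB : Matching → Fin n → Set
  MatchedB M b = isJust (mateB M b) ≡ true

  n₀ : Matching → ℕ
  n₀ M = size M

  -- LP: variables y_u for u ∈ (A ∪ B) ∖ U (values at unmatched nodes are ignored)
  Feasible : Matching → (Fin m → ℚ) → (Fin n → ℚ) → Set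
  Feasible M yA yB = ∀ a b → E a b ≡ true → MatchedA M a → MatchedB M b →
    wt M a b ≤ℚ (yA a +ℚ yB b)

  objective : Matching → (Fin m → ℚ) → (Fin n → ℚ) → ℚ
  objective M yA yB =
    sumℚ (λ a → if isJust (mateA M a) then yA a else 0ℚ)
    +ℚ sumℚ (λ b → if isJust (mateB M b) then yB b else 0ℚ)

  Optimal : Matching → (Fin m → ℚ) → (Fin n → ℚ) → Set
  Optimal M yA yB = Feasible M yA yB ×
    (∀ zA zB → Feasible M zA zB → objective M yA yB ≤ℚ objective M zA zB)

  dbl : ℕ → ℚ
  dbl k = + (2 * k) / 1

{-# OPTIONS --safe #-}
module Submission where

-- Write wt_M = 2ρ with ρ ∈ {−1, 0, 1} and consider the digraph on the matched
-- nodes of B with an arc v → u of weight ρ(M(v), u) whenever M(v) is adjacent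
-- to u.  Switching M along a walk of this digraph gives a matching N with
-- Δ(N, M) at least twice the weight of the walk plus the votes at its two ends.
-- Since M is popular among maximum matchings, every cycle has weight ≤ 0, so do
-- walks starting in Nbr(U_A) and walks ending at a node whose partner lies in
-- Nbr(U_B), and no walk does both (it would be an augmenting path).  Hence the
-- longest-walk potential d, in which walks starting in Nbr(U_A) get the head
-- start n₀ − 1, is computed by n₀ rounds of Bellman–Ford, lies in [0, n₀ − 1],
-- is n₀ − 1 on Nbr(U_A) and 0 at partners of Nbr(U_B).  The arc inequalities
-- d(v) + ρ(M(v), u) ≤ d(u) make α_b = 2 d(b), α_a = −2 d(M(a)) feasible, and
-- α is optimal: its objective is 0, while every feasible y has
-- y_a + y_{M(a)} ≥ wt_M(a, M(a)) = 0.

open import Defs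
open import Data.Nat using (ℕ; _<_; _∸_)
open import Data.Fin using (Fin)
open import Data.Bool using (true)
open import Data.Maybe using (Maybe; just; nothing)
open import Data.Product using (Σ; ∃; _×_; _,_)
open import Data.Rational using (ℚ; 0ℚ; -_)
open import Relation.Binary.PropositionalEquality using (_≡_; _≢_)
open import Function using (_∘_)
open import Algebra.Structures using (IsCommutativeMonoid)
import Data.Nat as ℕ
import Data.Nat.Properties as ℕP
import Data.Integer.Properties as ℤP
import Data.Rational.Properties as ℚP

nothing≢just : ∀ {X : Set} {x : X} → nothing ≢ just x
nothing≢just ()

module IntegerEmbedding where

  open import Data.Integer as ℤ using (ℤ; +_)
  open import Data.Rational using (_/_; toℚᵘ) renaming (_+_ to _+ℚ_; _≤_ to _≤ℚ_)
  open import Data.Rational.Unnormalised as ℚᵘ using (mkℚᵘ; *≡*; *≤*)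
  import Data.Rational.Unnormalised.Properties as ℚᵘP
  open import Relation.Binary.PropositionalEquality

  toℚ : ℤ → ℚ
  toℚ i = i / 1

  toℚᵘ-toℚ : ∀ i → toℚᵘ (toℚ i) ℚᵘ.≃ mkℚᵘ i 0
  toℚᵘ-toℚ i = ℚP.toℚᵘ-fromℚᵘ (mkℚᵘ i 0)

  toℚ-+ : ∀ i j → toℚ i +ℚ toℚ j ≡ toℚ (i ℤ.+ j)
  toℚ-+ i j = ℚP.toℚᵘ-injective (ℚᵘP.≃-trans (ℚP.toℚᵘ-homo-+ (toℚ i) (toℚ j))
    (ℚᵘP.≃-trans (ℚᵘP.+-cong (toℚᵘ-toℚ i) (toℚᵘ-toℚ j))
    (ℚᵘP.≃-trans (*≡* (cong (ℤ._* + 1) (cong₂ ℤ._+_ (ℤP.*-identityʳ i) (ℤP.*-identityʳ j))))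
      (ℚᵘP.≃-sym (toℚᵘ-toℚ (i ℤ.+ j))))))

  toℚ-neg : ∀ i → - toℚ i ≡ toℚ (ℤ.- i)
  toℚ-neg i = ℚP.toℚᵘ-injective (ℚᵘP.≃-trans (ℚP.toℚᵘ-homo‿- (toℚ i))
    (ℚᵘP.≃-trans (ℚᵘP.-‿cong (toℚᵘ-toℚ i)) (ℚᵘP.≃-sym (toℚᵘ-toℚ (ℤ.- i)))))

  toℚ-mono-≤ : ∀ {i j} → i ℤ.≤ j → toℚ i ≤ℚ toℚ j
  toℚ-mono-≤ {i} {j} i≤j = ℚP.toℚᵘ-cancel-≤
    (ℚᵘP.≤-respˡ-≃ (ℚᵘP.≃-sym (toℚᵘ-toℚ i)) (ℚᵘP.≤-respʳ-≃ (ℚᵘP.≃-sym (toℚᵘ-toℚ j))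
      (*≤* (ℤP.*-monoʳ-≤-nonNeg (+ 1) i≤j))))

module FiniteSums {C : Set} {_+_ : C → C → C} {0# : C}
  (isCommutativeMonoid : IsCommutativeMonoid _≡_ _+_ 0#) where

  open import Algebra.Bundles using (CommutativeMonoid)
  open import Data.Fin using (zero; suc; _≟_)
  open import Data.Fin.Properties using (suc-injective)
  open import Data.List using (List; []; _∷_; _++_; map)
  open import Data.List.Membership.Propositional using (_∈_; _∉_)
  open import Data.List.Relation.Unary.Any using (here; there)
  open import Data.List.Relation.Unary.All.Properties using (All¬⇒¬Any)
  open import Data.List.Relation.Unary.AllPairs using (_∷_)
  open import Data.List.Relation.Unary.Unique.Propositional using (Unique)
  open import Data.Empty using (⊥-elim)
  open import Function using (_∘_)
  open import Relation.Nullary using (yes; no)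
  open import Relation.Binary.PropositionalEquality

  open IsCommutativeMonoid isCommutativeMonoid using (assoc; identityˡ; identityʳ)

  commutativeMonoid : CommutativeMonoid _ _
  commutativeMonoid = record { isCommutativeMonoid = isCommutativeMonoid }

  open import Algebra.Properties.CommutativeSemigroup (CommutativeMonoid.commutativeSemigroup commutativeMonoid)
    using (interchange)

  open import Algebra.Properties.CommutativeMonoid.Sum commutativeMonoid public
    using (sum; sum-cong-≗; ∑-distrib-+; ∑-comm; sum-replicate-zero)

  sum-zero : ∀ {k} (f : Fin k → C) → (∀ i → f i ≡ 0#) → sum f ≡ 0#
  sum-zero {k} f f≗0 = trans (sum-cong-≗ f≗0) (sum-replicate-zero k)

  sum-point : ∀ {k} (f : Fin k → C) j → (∀ i → i ≢ j → f i ≡ 0#) → sum f ≡ f j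
  sum-point f zero off =
    trans (cong (f zero +_) (sum-zero (f ∘ suc) (λ i → off (suc i) λ ()))) (identityʳ (f zero))
  sum-point f (suc j) off =
    trans (cong₂ _+_ (off zero λ ()) (sum-point (f ∘ suc) j (λ i i≢j → off (suc i) (i≢j ∘ suc-injective))))
      (identityˡ (f (suc j)))

  sumₗ : ∀ {X : Set} → (X → C) → List X → C
  sumₗ f []       = 0#
  sumₗ f (x ∷ xs) = f x + sumₗ f xs

  module _ {X : Set} where

    sumₗ-cong : ∀ {f g : X → C} xs → (∀ {x} → x ∈ xs → f x ≡ g x) → sumₗ f xs ≡ sumₗ g xs
    sumₗ-cong []       f≗g = refl
    sumₗ-cong (x ∷ xs) f≗g = cong₂ _+_ (f≗g (here refl)) (sumₗ-cong xs (f≗g ∘ there))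

    sumₗ-zero : ∀ (f : X → C) xs → (∀ {x} → x ∈ xs → f x ≡ 0#) → sumₗ f xs ≡ 0#
    sumₗ-zero f xs f≗0 = trans (sumₗ-cong xs f≗0) (sumₗ-const xs)
      where
      sumₗ-const : ∀ xs → sumₗ (λ _ → 0#) xs ≡ 0#
      sumₗ-const []       = refl
      sumₗ-const (_ ∷ xs) = trans (identityˡ _) (sumₗ-const xs)

    sumₗ-++ : ∀ (f : X → C) xs ys → sumₗ f (xs ++ ys) ≡ sumₗ f xs + sumₗ f ys
    sumₗ-++ f []       ys = sym (identityˡ _)
    sumₗ-++ f (x ∷ xs) ys = trans (cong (f x +_) (sumₗ-++ f xs ys)) (sym (assoc _ _ _))

    sumₗ-map : ∀ {Y : Set} (f : Y → C) (g : X → Y) xs → sumₗ f (map g xs) ≡ sumₗ (f ∘ g) xs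
    sumₗ-map f g []       = refl
    sumₗ-map f g (x ∷ xs) = cong (f (g x) +_) (sumₗ-map f g xs)

    sumₗ-distrib-+ : ∀ (f g : X → C) xs → sumₗ (λ x → f x + g x) xs ≡ sumₗ f xs + sumₗ g xs
    sumₗ-distrib-+ f g []       = sym (identityˡ 0#)
    sumₗ-distrib-+ f g (x ∷ xs) = begin
      (f x + g x) + sumₗ (λ x → f x + g x) xs  ≡⟨ cong ((f x + g x) +_) (sumₗ-distrib-+ f g xs) ⟩
      (f x + g x) + (sumₗ f xs + sumₗ g xs)    ≡⟨ interchange (f x) (g x) (sumₗ f xs) (sumₗ g xs) ⟩
      (f x + sumₗ f xs) + (g x + sumₗ g xs)    ∎
      where open ≡-Reasoning

  sum-sumₗ-comm : ∀ {k} {X : Set} (h : Fin k → X → C) ys →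
    sum (λ i → sumₗ (h i) ys) ≡ sumₗ (λ y → sum (λ i → h i y)) ys
  sum-sumₗ-comm {k} h []       = sum-zero {k} (λ _ → 0#) (λ _ → refl)
  sum-sumₗ-comm     h (y ∷ ys) =
    trans (∑-distrib-+ (λ i → h i y) (λ i → sumₗ (h i) ys)) (cong (sum (λ i → h i y) +_) (sum-sumₗ-comm h ys))

  single : ∀ {k} → Fin k → C → Fin k → C
  single j v i with i ≟ j
  ... | yes _ = v
  ... | no  _ = 0#

  single-≡ : ∀ {k} (j : Fin k) v → single j v j ≡ v
  single-≡ j v with j ≟ j
  ... | yes _   = refl
  ... | no  j≢j = ⊥-elim (j≢j refl)

  single-≢ : ∀ {k} {i j : Fin k} v → i ≢ j → single j v i ≡ 0#
  single-≢ {i = i} {j} v i≢j with i ≟ j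
  ... | yes i≡j = ⊥-elim (i≢j i≡j)
  ... | no  _   = refl

  sum-single-diag : ∀ {k} (f : Fin k → C) j → sum (λ i → single j (f i) i) ≡ f j
  sum-single-diag f j = trans (sum-point _ j (λ i → single-≢ (f i))) (single-≡ j (f j))

  sumₗ-single : ∀ {k} (i : Fin k) v ys → Unique ys → (i ∉ ys → v ≡ 0#) →
    sumₗ (λ j → single j v i) ys ≡ v
  sumₗ-single i v []       _            i∉→0 = sym (i∉→0 λ ())
  sumₗ-single i v (y ∷ ys) (y∉ys ∷ uniq) i∉→0 with i ≟ y
  ... | yes refl = trans (cong (v +_) (sumₗ-zero _ ys (λ {j} j∈ys → single-≢ v (λ { refl → All¬⇒¬Any y∉ys j∈ys }))))
                     (identityʳ v)
  ... | no  i≢y  = trans (identityˡ _)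
                     (sumₗ-single i v ys uniq (λ i∉ys → i∉→0 λ { (here i≡y) → i≢y i≡y ; (there i∈ys) → i∉ys i∈ys }))

  sum-support : ∀ {k} (f : Fin k → C) ys → Unique ys → (∀ i → i ∉ ys → f i ≡ 0#) → sum f ≡ sumₗ f ys
  sum-support f ys uniq off = begin
    sum f                                            ≡⟨ sum-cong-≗ (λ i → sym (sumₗ-single i (f i) ys uniq (off i))) ⟩
    sum (λ i → sumₗ (λ j → single j (f i) i) ys)     ≡⟨ sum-sumₗ-comm (λ i j → single j (f i) i) ys ⟩
    sumₗ (λ j → sum (λ i → single j (f i) i)) ys     ≡⟨ sumₗ-cong ys (λ {j} _ → sum-single-diag f j) ⟩
    sumₗ f ys                                        ∎
    where open ≡-Reasoning


module ListFacts where

  open import Data.List using (List; []; _∷_; _++_; map; length)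
  open import Data.List.Membership.Propositional using (_∈_; _∉_)
  open import Data.List.Relation.Unary.Any using (here; there)
  open import Data.List.Relation.Unary.All.Properties using (All¬⇒¬Any; ¬Any⇒All¬)
  open import Data.List.Relation.Unary.AllPairs using ([]; _∷_)
  open import Data.List.Relation.Unary.Unique.Propositional using (Unique)
  open import Data.List.Relation.Unary.Linked using (Linked; [-]; _∷_)
  open import Data.List.Membership.Propositional.Properties using (∈-map⁻; ∈-∃++)
  open import Data.List.Relation.Unary.Any using (any?)
  open import Data.Sum using (_⊎_; inj₁; inj₂)
  open import Data.Empty using (⊥-elim)
  open import Relation.Nullary using (¬_; yes; no)
  open import Relation.Binary.Definitions using (DecidableEquality)
  open import Relation.Binary.PropositionalEquality

  module _ {X : Set} where

    lastOf : X → List X → X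
    lastOf x []       = x
    lastOf x (y ∷ ys) = lastOf y ys

    lastOf-∈ : ∀ x ys → lastOf x ys ∈ x ∷ ys
    lastOf-∈ x []       = here refl
    lastOf-∈ x (y ∷ ys) = there (lastOf-∈ y ys)

    lastOf-++ : ∀ x xs y ys → lastOf x (xs ++ y ∷ ys) ≡ lastOf y ys
    lastOf-++ x []        y ys = refl
    lastOf-++ x (x' ∷ xs) y ys = lastOf-++ x' xs y ys

    head∉tail : ∀ {x : X} {xs} → Unique (x ∷ xs) → x ∉ xs
    head∉tail (x∉xs ∷ _) = All¬⇒¬Any x∉xs

    data Consecutive : List X → X → X → Set where
      now   : ∀ {x y ys}   → Consecutive (x ∷ y ∷ ys) x y
      later : ∀ {z xs x y} → Consecutive xs x y → Consecutive (z ∷ xs) x y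

    Consecutive-∈₁ : ∀ {xs x y} → Consecutive xs x y → x ∈ xs
    Consecutive-∈₁ now       = here refl
    Consecutive-∈₁ (later c) = there (Consecutive-∈₁ c)

    Consecutive-∈₂ : ∀ {xs x y} → Consecutive xs x y → y ∈ xs
    Consecutive-∈₂ now       = there (here refl)
    Consecutive-∈₂ (later c) = there (Consecutive-∈₂ c)

    Consecutive-∈tail : ∀ {z xs x y} → Consecutive (z ∷ xs) x y → y ∈ xs
    Consecutive-∈tail now       = here refl
    Consecutive-∈tail (later c) = Consecutive-∈₂ c

    Consecutive-pred : ∀ {z xs y} → y ∈ xs → ∃ λ x → Consecutive (z ∷ xs) x y
    Consecutive-pred (here refl) = _ , now
    Consecutive-pred (there y∈)  = let x , c = Consecutive-pred y∈ in x , later c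

    Consecutive-injective : ∀ {xs} {x x' y : X} → Unique xs → Consecutive xs x y → Consecutive xs x' y → x ≡ x'
    Consecutive-injective _          now       now        = refl
    Consecutive-injective (_ ∷ uniq) now       (later c)  = ⊥-elim (head∉tail uniq (Consecutive-∈tail c))
    Consecutive-injective (_ ∷ uniq) (later c) now        = ⊥-elim (head∉tail uniq (Consecutive-∈tail c))
    Consecutive-injective (_ ∷ uniq) (later c) (later c') = Consecutive-injective uniq c c'

    length-loop< : ∀ (P Q : List X) y R → length (Q ++ y ∷ []) ℕ.< length (P ++ y ∷ Q ++ y ∷ R)
    length-loop< []      Q y R = ℕ.s≤s (short Q)
      where
      short : ∀ Q → length (Q ++ y ∷ []) ℕ.≤ length (Q ++ y ∷ R)
      short []      = ℕ.s≤s ℕ.z≤n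
      short (_ ∷ Q) = ℕ.s≤s (short Q)
    length-loop< (_ ∷ P) Q y R = ℕP.m≤n⇒m≤1+n (length-loop< P Q y R)

    length-cut< : ∀ (P Q : List X) y R → length (P ++ y ∷ R) ℕ.< length (P ++ y ∷ Q ++ y ∷ R)
    length-cut< []      Q y R = ℕ.s≤s (short Q)
      where
      short : ∀ Q → length R ℕ.< length (Q ++ y ∷ R)
      short []      = ℕP.n<1+n _
      short (_ ∷ Q) = ℕP.m<n⇒m<1+n (short Q)
    length-cut< (_ ∷ P) Q y R = ℕ.s≤s (length-cut< P Q y R)

    cut-head : ∀ {b : X} {r} P y Q R → b ∷ r ≡ P ++ y ∷ Q ++ y ∷ R →
      ∃ λ r' → P ++ y ∷ R ≡ b ∷ r' × length r' ℕ.< length r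
    cut-head []      y Q R refl = R , refl , ℕ.s<s⁻¹ (length-cut< [] Q y R)
    cut-head (p ∷ P) y Q R refl = P ++ y ∷ R , refl , length-cut< P Q y R

    lastOf-cut : ∀ (x : X) P y Q R → lastOf x (P ++ y ∷ Q ++ y ∷ R) ≡ lastOf x (P ++ y ∷ R)
    lastOf-cut x P y Q R = trans (lastOf-++ x P y (Q ++ y ∷ R)) (trans (lastOf-++ y Q y R) (sym (lastOf-++ x P y R)))

  module _ {X : Set} (_≟_ : DecidableEquality X) where

    Loop : List X → Set
    Loop xs = Σ (List X × X × List X × List X) λ (P , y , Q , R) → xs ≡ P ++ y ∷ Q ++ y ∷ R

    unique⊎loop : ∀ xs → Unique xs ⊎ Loop xs
    unique⊎loop []       = inj₁ []
    unique⊎loop (x ∷ xs) with any? (x ≟_) xs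
    ... | yes x∈xs = let Q , R , xs≡ = ∈-∃++ x∈xs in inj₂ (([] , x , Q , R) , cong (x ∷_) xs≡)
    ... | no  x∉xs with unique⊎loop xs
    ...   | inj₁ uniq = inj₁ (¬Any⇒All¬ xs x∉xs ∷ uniq)
    ...   | inj₂ ((P , y , Q , R) , xs≡) = inj₂ ((x ∷ P , y , Q , R) , cong (x ∷_) xs≡)

  module _ {X : Set} {R : X → X → Set} where

    Linked-split : ∀ xs {y ys} → Linked R (xs ++ y ∷ ys) → Linked R (xs ++ y ∷ []) × Linked R (y ∷ ys)
    Linked-split []            linked       = [-] , linked
    Linked-split (x ∷ [])      (r ∷ linked) = (r ∷ [-]) , linked
    Linked-split (x ∷ x' ∷ xs) (r ∷ linked) with Linked-split (x' ∷ xs) linked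
    ... | front , back = (r ∷ front) , back

    Linked-join : ∀ xs {y ys} → Linked R (xs ++ y ∷ []) → Linked R (y ∷ ys) → Linked R (xs ++ y ∷ ys)
    Linked-join []            _           back = back
    Linked-join (x ∷ [])      (r ∷ _)     back = r ∷ back
    Linked-join (x ∷ x' ∷ xs) (r ∷ front) back = r ∷ Linked-join (x' ∷ xs) front back

    Linked-cut : ∀ P {y} Q {ys} → Linked R (P ++ y ∷ Q ++ y ∷ ys) → Linked R (P ++ y ∷ ys) × Linked R (y ∷ Q ++ y ∷ [])
    Linked-cut P {y} Q linked with Linked-split P linked
    ... | front , middle with Linked-split (y ∷ Q) middle
    ...   | loop , back = Linked-join P front back , loop

  map⁺-injectiveOn : ∀ {X Y : Set} (f : X → Y) xs →
    (∀ {x x'} → x ∈ xs → x' ∈ xs → f x ≡ f x' → x ≡ x') → Unique xs → Unique (map f xs)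
  map⁺-injectiveOn f []       _   _            = []
  map⁺-injectiveOn f (x ∷ xs) inj (x∉xs ∷ uniq) =
    ¬Any⇒All¬ _ fx∉ ∷ map⁺-injectiveOn f xs (λ i j → inj (there i) (there j)) uniq
    where
    fx∉ : ¬ (f x ∈ map f xs)
    fx∉ fx∈ = let x' , x'∈ , fx≡fx' = ∈-map⁻ f fx∈ in
      All¬⇒¬Any x∉xs (subst (_∈ xs) (sym (inj (here refl) (there x'∈) fx≡fx')) x'∈)

module ℤSum = FiniteSums ℤP.+-0-isCommutativeMonoid
module ℚSum = FiniteSums ℚP.+-0-isCommutativeMonoid

module IntegerFacts where

  open import Data.Nat using (_<ᵇ_)
  open import Data.Fin using (zero; suc)
  open import Data.Bool using (Bool; false; if_then_else_; _∧_)
  open import Data.Integer as ℤ using (ℤ; +_; -[1+_]; _+_; _-_; _≤_)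
  open import Data.Integer.Properties using (≤-refl)
  open import Relation.Binary.PropositionalEquality
  open import Relation.Nullary.Reflects using (ofʸ; ofⁿ)
  open import Data.Integer.Solver using (module +-*-Solver)
  open +-*-Solver using (solve; _:+_; _:-_; :-_; _:=_)
  open import Data.Empty using (⊥-elim)

  ⟦_⟧ : Bool → ℤ
  ⟦ true  ⟧ = + 1
  ⟦ false ⟧ = + 0

  count≡sum : ∀ {k} (f : Fin k → Bool) → + count f ≡ ℤSum.sum (λ i → ⟦ f i ⟧)
  count≡sum {ℕ.zero}  f = refl
  count≡sum {ℕ.suc k} f with f zero
  ... | true  = trans (ℤP.pos-+ 1 _) (cong (_+_ (+ 1)) (count≡sum (λ i → f (suc i))))
  ... | false = trans (count≡sum (λ i → f (suc i))) (sym (ℤP.+-identityˡ _))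

  +-minus-+ : ∀ w x y z → (w + x) - (y + z) ≡ (w - y) + (x - z)
  +-minus-+ = solve 4 (λ w x y z → (w :+ x) :- (y :+ z) := (w :- y) :+ (x :- z)) refl

  sum-minus : ∀ {k} (f g : Fin k → ℤ) → ℤSum.sum (λ i → f i - g i) ≡ ℤSum.sum f - ℤSum.sum g
  sum-minus {ℕ.zero}  f g = refl
  sum-minus {ℕ.suc k} f g = begin
    (f zero - g zero) + ℤSum.sum (λ i → f (suc i) - g (suc i))
      ≡⟨ cong (_+_ (f zero - g zero)) (sum-minus (λ i → f (suc i)) (λ i → g (suc i))) ⟩
    (f zero - g zero) + (ℤSum.sum (λ i → f (suc i)) - ℤSum.sum (λ i → g (suc i)))
      ≡⟨ sym (+-minus-+ (f zero) _ (g zero) _) ⟩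
    (f zero + ℤSum.sum (λ i → f (suc i))) - (g zero + ℤSum.sum (λ i → g (suc i))) ∎
    where open ≡-Reasoning

  sum-mono-≤ : ∀ {k} {f g : Fin k → ℤ} → (∀ i → f i ≤ g i) → ℤSum.sum f ≤ ℤSum.sum g
  sum-mono-≤ {ℕ.zero}  _   = ≤-refl
  sum-mono-≤ {ℕ.suc k} f≤g = ℤP.+-mono-≤ (f≤g zero) (sum-mono-≤ (f≤g ∘ suc))

  -1≤⟦⟧-⟦⟧ : ∀ p q → -[1+ 0 ] ≤ ⟦ p ⟧ - ⟦ q ⟧
  -1≤⟦⟧-⟦⟧ true  true  = ℤ.-≤+
  -1≤⟦⟧-⟦⟧ true  false = ℤ.-≤+
  -1≤⟦⟧-⟦⟧ false true  = ≤-refl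
  -1≤⟦⟧-⟦⟧ false false = ℤ.-≤+

  x+x≤1⇒x≤0 : ∀ x → x + x ≤ + 1 → x ≤ + 0
  x+x≤1⇒x≤0 (+ ℕ.zero)  _         = ≤-refl
  x+x≤1⇒x≤0 (+ ℕ.suc k) (ℤ.+≤+ le) with subst (ℕ._≤ 1) (cong ℕ.suc (ℕP.+-suc k k)) le
  ... | ℕ.s≤s ()
  x+x≤1⇒x≤0 -[1+ k ]    _         = ℤ.-≤+

  pos-2* : ∀ k → + (2 ℕ.* k) ≡ + k + + k
  pos-2* k = trans (cong (λ j → + (k ℕ.+ j)) (ℕP.+-identityʳ k)) (ℤP.pos-+ k k)

  r+r≤2y-2x : ∀ (x y : ℕ) r → + x + r ≤ + y → r + r ≤ ℤ.- + (2 ℕ.* x) + + (2 ℕ.* y)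
  r+r≤2y-2x x y r x+r≤y rewrite pos-2* x | pos-2* y =
    subst (_≤ ℤ.- (+ x + + x) + (+ y + + y)) (cancel (+ x) r) (ℤP.+-monoʳ-≤ (ℤ.- (+ x + + x)) (ℤP.+-mono-≤ x+r≤y x+r≤y))
    where
    cancel : ∀ w r → ℤ.- (w + w) + ((w + r) + (w + r)) ≡ r + r
    cancel = solve 2 (λ w r → (:- (w :+ w)) :+ ((w :+ r) :+ (w :+ r)) := r :+ r) refl

  edgeSign : Bool → Bool → Bool → Bool → ℤ
  edgeSign p q p' q' = if p ∧ q then + 1 else if p' ∧ q' then -[1+ 0 ] else + 0

  edgeSign≤1 : ∀ p q p' q' → edgeSign p q p' q' ≤ + 1
  edgeSign≤1 true  true  _     _     = ≤-refl
  edgeSign≤1 true  false true  true  = ℤ.-≤+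
  edgeSign≤1 true  false true  false = ℤ.+≤+ ℕ.z≤n
  edgeSign≤1 true  false false _     = ℤ.+≤+ ℕ.z≤n
  edgeSign≤1 false _     true  true  = ℤ.-≤+
  edgeSign≤1 false _     true  false = ℤ.+≤+ ℕ.z≤n
  edgeSign≤1 false _     false _     = ℤ.+≤+ ℕ.z≤n

  data Opposite : Bool → Bool → Set where
    true-false : Opposite true false
    false-true : Opposite false true

  <ᵇ-opposite : ∀ r s → r ≢ s → Opposite (r <ᵇ s) (s <ᵇ r)
  <ᵇ-opposite r s r≢s with r <ᵇ s | ℕP.<ᵇ-reflects-< r s | s <ᵇ r | ℕP.<ᵇ-reflects-< s r
  ... | true  | _       | false | _       = true-false
  ... | false | _       | true  | _       = false-true
  ... | true  | ofʸ r<s | true  | ofʸ s<r = ⊥-elim (ℕP.<-asym r<s s<r)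
  ... | false | ofⁿ r≮s | false | ofⁿ s≮r = ⊥-elim (r≢s (ℕP.≤-antisym (ℕP.≮⇒≥ s≮r) (ℕP.≮⇒≥ r≮s)))

  <ᵇ-irrefl : ∀ r → (r <ᵇ r) ≡ false
  <ᵇ-irrefl ℕ.zero    = refl
  <ᵇ-irrefl (ℕ.suc r) = <ᵇ-irrefl r

  edgeSign-≤-votes : ∀ {p p' q q'} → Opposite p p' → Opposite q q' →
    edgeSign p q p' q' + edgeSign p q p' q' ≤ (⟦ p ⟧ - ⟦ p' ⟧) + (⟦ q ⟧ - ⟦ q' ⟧)
  edgeSign-≤-votes true-false true-false = ≤-refl
  edgeSign-≤-votes true-false false-true = ≤-refl
  edgeSign-≤-votes false-true true-false = ≤-refl
  edgeSign-≤-votes false-true false-true = ≤-refl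

module OptionalMaximum where

  open import Data.Fin using (zero; suc)
  open import Data.Integer using (ℤ; _≤_; _⊔_)
  open import Data.Sum using (_⊎_; inj₁; inj₂)
  open import Relation.Binary.PropositionalEquality

  insert : Maybe ℤ → ℤ → ℤ
  insert nothing  s = s
  insert (just v) s = v ⊔ s

  maxOver : ∀ {k} → (Fin k → Maybe ℤ) → ℤ → ℤ
  maxOver {ℕ.zero}  f s = s
  maxOver {ℕ.suc k} f s = maxOver (f ∘ suc) (insert (f zero) s)

  ≤insert : ∀ o s → s ≤ insert o s
  ≤insert nothing  s = ℤP.≤-refl
  ≤insert (just v) s = ℤP.i≤j⊔i v s

  ≤maxOver : ∀ {k} (f : Fin k → Maybe ℤ) s → s ≤ maxOver f s
  ≤maxOver {ℕ.zero}  f s = ℤP.≤-refl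
  ≤maxOver {ℕ.suc k} f s = ℤP.≤-trans (≤insert (f zero) s) (≤maxOver (f ∘ suc) (insert (f zero) s))

  candidate≤maxOver : ∀ {k} (f : Fin k → Maybe ℤ) s {i v} → f i ≡ just v → v ≤ maxOver f s
  candidate≤maxOver f s {zero} fi≡v rewrite fi≡v = ℤP.≤-trans (ℤP.i≤i⊔j _ s) (≤maxOver (f ∘ suc) _)
  candidate≤maxOver f s {suc i} fi≡v = candidate≤maxOver (f ∘ suc) (insert (f zero) s) fi≡v

  maxOver-attained : ∀ {k} (f : Fin k → Maybe ℤ) s → maxOver f s ≡ s ⊎ ∃ λ i → f i ≡ just (maxOver f s)
  maxOver-attained {ℕ.zero}  f s = inj₁ refl
  maxOver-attained {ℕ.suc k} f s with maxOver-attained (f ∘ suc) (insert (f zero) s)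
  ... | inj₂ (i , fi≡max) = inj₂ (suc i , fi≡max)
  ... | inj₁ max≡ with f zero in f0≡
  ...   | nothing = inj₁ max≡
  ...   | just v with ℤP.⊔-sel v s
  ...     | inj₁ v⊔s≡v = inj₂ (zero , trans f0≡ (cong just (sym (trans max≡ v⊔s≡v))))
  ...     | inj₂ v⊔s≡s = inj₁ (trans max≡ v⊔s≡s)

module MatchingFacts {m n : ℕ} (G : PrefGraph m n) (M : Matching G) where

  open PrefGraph G
  open import Data.Nat using (_<ᵇ_)
  open import Data.Fin using (_≟_)
  open import Data.Bool using (Bool; false; _∧_)
  open import Data.Maybe.Properties using (just-injective)
  open import Data.Integer using (ℤ; +_; -[1+_]; _+_; _-_; _≤_)
  open import Relation.Nullary using (yes; no)
  open import Relation.Binary.PropositionalEquality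
  open IntegerEmbedding
  open IntegerFacts

  mateB-injective : ∀ {b b' a} → mateB M b ≡ just a → mateB M b' ≡ just a → b ≡ b'
  mateB-injective Mb Mb' = just-injective (trans (sym (consBA M _ _ Mb)) (consBA M _ _ Mb'))

  halfWt : Fin m → Fin n → ℤ
  halfWt a b = edgeSign (aPrefersOther G M a b) (bPrefersOther G M b a) (aPrefersOwn G M a b) (bPrefersOwn G M b a)

  wt≡toℚ-2·halfWt : ∀ a b → wt G M a b ≡ toℚ (halfWt a b + halfWt a b)
  wt≡toℚ-2·halfWt a b with aPrefersOther G M a b ∧ bPrefersOther G M b a
  ... | true  = refl
  ... | false with aPrefersOwn G M a b ∧ bPrefersOwn G M b a
  ...   | true  = refl
  ...   | false = refl

  halfWt-matched : ∀ {a b y a₀} → mateA M a ≡ just y → mateB M b ≡ just a₀ →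
    halfWt a b ≡ edgeSign (rankA a b <ᵇ rankA a y) (rankB b a <ᵇ rankB b a₀) (rankA a y <ᵇ rankA a b) (rankB b a₀ <ᵇ rankB b a)
  halfWt-matched Ma Mb rewrite Ma | Mb = refl

  halfWt-mate : ∀ {a b} → mateA M a ≡ just b → halfWt a b ≡ + 0
  halfWt-mate {a} {b} Ma rewrite halfWt-matched Ma (consAB M a b Ma) | <ᵇ-irrefl (rankA a b) = refl

  halfWt≤1 : ∀ a b → halfWt a b ≤ + 1
  halfWt≤1 a b = edgeSign≤1 (aPrefersOther G M a b) (bPrefersOther G M b a) (aPrefersOwn G M a b) (bPrefersOwn G M b a)

  prefOptA-refl : ∀ a o → prefOptA G a o o ≡ false
  prefOptA-refl a (just b) = <ᵇ-irrefl (rankA a b)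
  prefOptA-refl a nothing  = refl

  prefOptB-refl : ∀ b o → prefOptB G b o o ≡ false
  prefOptB-refl b (just a) = <ᵇ-irrefl (rankB b a)
  prefOptB-refl b nothing  = refl

  module _ (N : Matching G) where

    voteA : Fin m → ℤ
    voteA a = ⟦ prefOptA G a (mateA N a) (mateA M a) ⟧ - ⟦ prefOptA G a (mateA M a) (mateA N a) ⟧

    voteB : Fin n → ℤ
    voteB b = ⟦ prefOptB G b (mateB N b) (mateB M b) ⟧ - ⟦ prefOptB G b (mateB M b) (mateB N b) ⟧

    sizeChange : Fin m → ℤ
    sizeChange a = ⟦ isJust (mateA N a) ⟧ - ⟦ isJust (mateA M a) ⟧

    φ-difference : + φ G N M - + φ G M N ≡ ℤSum.sum voteA + ℤSum.sum voteB
    φ-difference = begin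
      + φ G N M - + φ G M N                  ≡⟨ cong₂ _-_ (counts≡sums prefA₁ prefB₁) (counts≡sums prefA₂ prefB₂) ⟩
      (ΣA₁ + ΣB₁) - (ΣA₂ + ΣB₂)              ≡⟨ +-minus-+ ΣA₁ ΣB₁ ΣA₂ ΣB₂ ⟩
      (ΣA₁ - ΣA₂) + (ΣB₁ - ΣB₂)              ≡⟨ sym (cong₂ _+_ (sum-minus (λ a → ⟦ prefA₁ a ⟧) (λ a → ⟦ prefA₂ a ⟧))
                                                                (sum-minus (λ b → ⟦ prefB₁ b ⟧) (λ b → ⟦ prefB₂ b ⟧))) ⟩
      ℤSum.sum voteA + ℤSum.sum voteB        ∎
      where
      open ≡-Reasoning
      prefA₁ prefA₂ : Fin m → Bool
      prefA₁ a = prefOptA G a (mateA N a) (mateA M a)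
      prefA₂ a = prefOptA G a (mateA M a) (mateA N a)
      prefB₁ prefB₂ : Fin n → Bool
      prefB₁ b = prefOptB G b (mateB N b) (mateB M b)
      prefB₂ b = prefOptB G b (mateB M b) (mateB N b)
      ΣA₁ = ℤSum.sum (λ a → ⟦ prefA₁ a ⟧)
      ΣA₂ = ℤSum.sum (λ a → ⟦ prefA₂ a ⟧)
      ΣB₁ = ℤSum.sum (λ b → ⟦ prefB₁ b ⟧)
      ΣB₂ = ℤSum.sum (λ b → ⟦ prefB₂ b ⟧)
      counts≡sums : ∀ (f : Fin m → Bool) (g : Fin n → Bool) →
        + (count f ℕ.+ count g) ≡ ℤSum.sum (λ a → ⟦ f a ⟧) + ℤSum.sum (λ b → ⟦ g b ⟧)
      counts≡sums f g = trans (ℤP.pos-+ (count f) (count g)) (cong₂ _+_ (count≡sum f) (count≡sum g))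

    size-difference : + size G N - + size G M ≡ ℤSum.sum sizeChange
    size-difference = trans (cong₂ _-_ (count≡sum matchedN) (count≡sum matchedM))
      (sym (sum-minus (λ a → ⟦ matchedN a ⟧) (λ a → ⟦ matchedM a ⟧)))
      where
      matchedN matchedM : Fin m → Bool
      matchedN a = isJust (mateA N a)
      matchedM a = isJust (mateA M a)

    voteA-unchanged : ∀ {a} → mateA N a ≡ mateA M a → voteA a ≡ + 0
    voteA-unchanged {a} eq rewrite eq | prefOptA-refl a (mateA M a) = refl

    voteB-unchanged : ∀ {b} → mateB N b ≡ mateB M b → voteB b ≡ + 0
    voteB-unchanged {b} eq rewrite eq | prefOptB-refl b (mateB M b) = refl

    sizeChange-unchanged : ∀ {a} → mateA N a ≡ mateA M a → sizeChange a ≡ + 0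
    sizeChange-unchanged {a} eq rewrite eq = ℤP.+-inverseʳ ⟦ isJust (mateA M a) ⟧

    sizeChange-≡ : ∀ {a o o'} → mateA N a ≡ o → mateA M a ≡ o' → sizeChange a ≡ ⟦ isJust o ⟧ - ⟦ isJust o' ⟧
    sizeChange-≡ refl refl = refl

    voteA≥-1 : ∀ a → -[1+ 0 ] ≤ voteA a
    voteA≥-1 a = -1≤⟦⟧-⟦⟧ (prefOptA G a (mateA N a) (mateA M a)) (prefOptA G a (mateA M a) (mateA N a))

    voteB≥-1 : ∀ b → -[1+ 0 ] ≤ voteB b
    voteB≥-1 b = -1≤⟦⟧-⟦⟧ (prefOptB G b (mateB N b) (mateB M b)) (prefOptB G b (mateB M b) (mateB N b))

    voteA-gain : ∀ {a b} → mateA N a ≡ just b → mateA M a ≡ nothing → voteA a ≡ + 1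
    voteA-gain Na Ma rewrite Na | Ma = refl

    voteB-gain : ∀ {b a} → mateB N b ≡ just a → mateB M b ≡ nothing → voteB b ≡ + 1
    voteB-gain Nb Mb rewrite Nb | Mb = refl

    2·halfWt≤votes : ∀ {a b y a₀} → mateA N a ≡ just b → mateB N b ≡ just a →
      mateA M a ≡ just y → mateB M b ≡ just a₀ → E a b ≡ true →
      halfWt a b + halfWt a b ≤ voteA a + voteB b
    2·halfWt≤votes {a} {b} {y} {a₀} Na Nb Ma Mb ab with y ≟ b
    ... | yes refl = subst₂ _≤_ (sym (cong₂ _+_ (halfWt-mate Ma) (halfWt-mate Ma)))
                       (sym (cong₂ _+_ (voteA-unchanged (trans Na (sym Ma))) (voteB-unchanged (trans Nb (sym (consAB M a y Ma))))))
                       ℤP.≤-refl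
    ... | no y≢b rewrite halfWt-matched {b = b} Ma Mb | Na | Nb | Ma | Mb =
      edgeSign-≤-votes (<ᵇ-opposite (rankA a b) (rankA a y) (λ r≡ → y≢b (sym (strictA a b y ab (inE M a y Ma) r≡))))
                       (<ᵇ-opposite (rankB b a) (rankB b a₀)
                         (λ r≡ → a≢a₀ (strictB b a a₀ ab (inE M a₀ b (consBA M a₀ b Mb)) r≡)))
      where
      a≢a₀ : a ≢ a₀
      a≢a₀ refl = y≢b (just-injective (trans (sym Ma) (consBA M a b Mb)))

module MatchingFromMateB {m n : ℕ} (G : PrefGraph m n) (mate : Fin n → Maybe (Fin m))
  (mate-injective : ∀ {b b' a} → mate b ≡ just a → mate b' ≡ just a → b ≡ b')
  (mate-edge : ∀ {b a} → mate b ≡ just a → PrefGraph.E G a b ≡ true) where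

  open import Data.Fin using (_≟_)
  open import Data.Fin.Properties using (any?)
  open import Data.Maybe.Properties using (≡-dec)
  open import Data.Empty using (⊥-elim)
  open import Relation.Nullary using (yes; no)
  open import Relation.Binary.PropositionalEquality

  inverse : Fin m → Maybe (Fin n)
  inverse a with any? (λ b → ≡-dec _≟_ (mate b) (just a))
  ... | yes (b , _) = just b
  ... | no  _       = nothing

  inverse-sound : ∀ {a b} → inverse a ≡ just b → mate b ≡ just a
  inverse-sound {a} eq with any? (λ b → ≡-dec _≟_ (mate b) (just a))
  inverse-sound {a} refl | yes (_ , mate-b≡a) = mate-b≡a

  inverse-complete : ∀ {a b} → mate b ≡ just a → inverse a ≡ just b
  inverse-complete {a} {b} mate-b≡a with any? (λ b → ≡-dec _≟_ (mate b) (just a))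
  ... | yes (b' , mate-b'≡a) = cong just (mate-injective mate-b'≡a mate-b≡a)
  ... | no  none             = ⊥-elim (none (b , mate-b≡a))

  inverse-nothing : ∀ {a} → (∀ b → mate b ≢ just a) → inverse a ≡ nothing
  inverse-nothing {a} unused with any? (λ b → ≡-dec _≟_ (mate b) (just a))
  ... | yes (b , mate-b≡a) = ⊥-elim (unused b mate-b≡a)
  ... | no  _              = refl

  matching : Matching G
  matching = record
    { mateA  = inverse
    ; mateB  = mate
    ; consAB = λ _ _ → inverse-sound
    ; consBA = λ _ _ → inverse-complete
    ; inE    = λ _ _ → mate-edge ∘ inverse-sound
    }

module MatchedSums {C : Set} {_+_ : C → C → C} {0# : C} (isCommutativeMonoid : IsCommutativeMonoid _≡_ _+_ 0#)
  {m n : ℕ} (G : PrefGraph m n) (M : Matching G) where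

  open FiniteSums isCommutativeMonoid
  open import Data.Bool using (if_then_else_)
  open import Data.Fin using (_≟_)
  open import Data.Maybe.Properties using (just-injective)
  open import Data.Empty using (⊥-elim)
  open import Relation.Nullary using (yes; no)
  open import Relation.Binary.PropositionalEquality

  atMate : (Fin n → C) → Maybe (Fin n) → C
  atMate f (just b) = f b
  atMate f nothing  = 0#

  onMate : (Fin n → C) → Fin m → Fin n → C
  onMate f a b with mateA M a
  ... | just b' = single b' (f b) b
  ... | nothing = 0#

  sum-onMate-row : ∀ f a → sum (onMate f a) ≡ atMate f (mateA M a)
  sum-onMate-row f a with mateA M a
  ... | just b' = sum-single-diag f b'
  ... | nothing = sum-zero {n} (λ _ → 0#) (λ _ → refl)

  onMate-other : ∀ f {a b} → mateA M a ≢ just b → onMate f a b ≡ 0#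
  onMate-other f {a} {b} Ma≢b with mateA M a
  ... | nothing = refl
  ... | just b' with b' ≟ b
  ...   | yes refl = ⊥-elim (Ma≢b refl)
  ...   | no  b'≢b = single-≢ (f b) (b'≢b ∘ sym)

  sum-onMate-column : ∀ f b → sum (λ a → onMate f a b) ≡ (if isJust (mateB M b) then f b else 0#)
  sum-onMate-column f b with mateB M b in Mb
  ... | nothing = sum-zero _ (λ a → onMate-other f (λ Ma → nothing≢just (trans (sym Mb) (consAB M a b Ma))))
  ... | just a₀ = trans (sum-point _ a₀ (λ a a≢a₀ → onMate-other f (λ Ma → a≢a₀ (just-injective (trans (sym (consAB M a b Ma)) Mb)))))
                    own
    where
    own : onMate f a₀ b ≡ f b
    own rewrite consBA M a₀ b Mb = single-≡ b (f b)

  sum-matchedB : ∀ f → sum (λ b → if isJust (mateB M b) then f b else 0#) ≡ sum (λ a → atMate f (mateA M a))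
  sum-matchedB f = begin
    sum (λ b → if isJust (mateB M b) then f b else 0#)  ≡⟨ sum-cong-≗ (λ b → sym (sum-onMate-column f b)) ⟩
    sum (λ b → sum (λ a → onMate f a b))                ≡⟨ ∑-comm (λ b a → onMate f a b) ⟩
    sum (λ a → sum (onMate f a))                        ≡⟨ sum-cong-≗ (sum-onMate-row f) ⟩
    sum (λ a → atMate f (mateA M a))                    ∎
    where open ≡-Reasoning

module Switching {m n : ℕ} (G : PrefGraph m n) (M : Matching G) where

  open PrefGraph G
  open MatchingFacts G M
  open ListFacts
  open IntegerFacts using (x+x≤1⇒x≤0)
  open ℤSum using (sum; sumₗ; sumₗ-++; sumₗ-map; sumₗ-zero; sumₗ-distrib-+; sum-support)
  open import Data.Integer.Solver using (module +-*-Solver)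
  open +-*-Solver using (solve; _:+_; _:=_; con)
  open import Data.Fin using (_≟_)
  open import Data.Maybe.Properties using (just-injective)
  open import Data.Integer as ℤ using (ℤ; +_; -[1+_]; _+_; _-_; _≤_)
  open import Data.List using (List; []; _∷_; _++_; map; fromMaybe)
  open import Data.List.Membership.Propositional using (_∈_; _∉_)
  open import Data.List.Membership.Propositional.Properties using (∈-map⁺; ∈-map⁻; ∈-++⁺ˡ; ∈-++⁺ʳ)
  open import Data.List.Relation.Unary.Any using (here; there)
  open import Data.List.Relation.Unary.AllPairs using ([]; _∷_)
  open import Data.List.Relation.Unary.All using ([])
  open import Data.List.Relation.Unary.Unique.Propositional using (Unique)
  import Data.List.Relation.Unary.Unique.Propositional.Properties as Unique
  open import Data.List.Relation.Unary.Linked using (Linked; _∷_)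
  open import Data.Product using (proj₁; proj₂)
  open import Data.Sum using (_⊎_; inj₁; inj₂)
  open import Data.Empty using (⊥; ⊥-elim)
  open import Relation.Nullary using (¬_; yes; no)
  open import Relation.Binary.PropositionalEquality

  -- u ⟵ v is an arc from v to u.  Walks are stored backwards as lists linked
  -- by _⟵_, so the head of the list is where the walk ends.
  _⟵_ : Fin n → Fin n → Set
  u ⟵ v = Σ (Fin m) λ a → mateB M v ≡ just a × E a u ≡ true × MatchedB G M u

  arcWt : Fin n → Fin n → ℤ
  arcWt v u with mateB M v
  ... | just a  = halfWt a u
  ... | nothing = + 0

  arcWt-≡ : ∀ {v a} u → mateB M v ≡ just a → arcWt v u ≡ halfWt a u
  arcWt-≡ u Mv rewrite Mv = refl

  walkWt : List (Fin n) → ℤ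
  walkWt []           = + 0
  walkWt (_ ∷ [])     = + 0
  walkWt (x ∷ y ∷ ys) = arcWt y x + walkWt (y ∷ ys)

  Consecutive⇒⟵ : ∀ {xs x y} → Linked _⟵_ xs → Consecutive xs x y → x ⟵ y
  Consecutive⇒⟵ (x⟵y ∷ _)     now       = x⟵y
  Consecutive⇒⟵ (_   ∷ linked) (later c) = Consecutive⇒⟵ linked c

  data TailEnd (a₀ : Fin m) (last : Fin n) (headEnd : Maybe (Fin n)) : Set where
    unmatched : TailEnd a₀ last headEnd
    toFree    : ∀ a → mateA M a ≡ nothing → E a last ≡ true → TailEnd a₀ last headEnd
    close     : headEnd ≡ nothing → E a₀ last ≡ true → TailEnd a₀ last headEnd

  -- Every node of the walk b₀ ∷ bs takes the partner of its predecessor on the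
  -- walk (the next list element); the walk's first node (lastOf b₀ bs) is
  -- rematched as tailEnd says, and a free node headEnd adjacent to a₀ may take a₀.
  module Along (b₀ : Fin n) (bs : List (Fin n)) (a₀ : Fin m) (b₀a₀ : mateB M b₀ ≡ just a₀)
    (unique : Unique (b₀ ∷ bs)) (linked : Linked _⟵_ (b₀ ∷ bs))
    (headEnd : Maybe (Fin n)) (headEnd-free : ∀ {u} → headEnd ≡ just u → mateB M u ≡ nothing × E a₀ u ≡ true)
    (tailEnd : TailEnd a₀ (lastOf b₀ bs) headEnd) where

    walk : List (Fin n)
    walk = b₀ ∷ bs

    last : Fin n
    last = lastOf b₀ bs

    partner : Fin n → Fin m
    partner b with mateB M b
    ... | just a  = a
    ... | nothing = a₀

    partner-≡ : ∀ {b a} → mateB M b ≡ just a → partner b ≡ a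
    partner-≡ Mb rewrite Mb = refl

    mateB-partner : ∀ {y} → y ∈ walk → mateB M y ≡ just (partner y)
    mateB-partner (here refl) = trans b₀a₀ (cong just (sym (partner-≡ b₀a₀)))
    mateB-partner (there y∈bs) with Consecutive-pred {z = b₀} y∈bs
    ... | _ , c with Consecutive⇒⟵ linked c
    ...   | _ , My , _ = trans My (cong just (sym (partner-≡ My)))

    mateA-partner : ∀ {y} → y ∈ walk → mateA M (partner y) ≡ just y
    mateA-partner y∈ = consBA M _ _ (mateB-partner y∈)

    mateA-a₀ : mateA M a₀ ≡ just b₀
    mateA-a₀ = consBA M a₀ b₀ b₀a₀

    partner-tail≢a₀ : ∀ {y} → y ∈ bs → partner y ≢ a₀
    partner-tail≢a₀ {y} y∈bs py≡a₀ =
      head∉tail unique (subst (_∈ bs) (mateB-injective (trans (mateB-partner (there y∈bs)) (cong just py≡a₀)) b₀a₀) y∈bs)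

    walk-matched : ∀ {y} → y ∈ walk → mateB M y ≢ nothing
    walk-matched y∈ My≡nothing = nothing≢just (trans (sym My≡nothing) (mateB-partner y∈))

    lastMate : TailEnd a₀ last headEnd → Maybe (Fin m)
    lastMate unmatched      = nothing
    lastMate (toFree a _ _) = just a
    lastMate (close _ _)    = just a₀

    freed : TailEnd a₀ last headEnd → List (Fin m)
    freed unmatched      = []
    freed (toFree a _ _) = a ∷ []
    freed (close _ _)    = []

    lastMate-edge : ∀ t {a} → lastMate t ≡ just a → E a last ≡ true
    lastMate-edge (toFree a _ a-last) refl = a-last
    lastMate-edge (close _ a₀-last)   refl = a₀-last

    lastMate-cases : ∀ t {a} → lastMate t ≡ just a → a ∈ freed t ⊎ (a ≡ a₀ × headEnd ≡ nothing)
    lastMate-cases (toFree a _ _) refl = inj₁ (here refl)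
    lastMate-cases (close noHead _) refl = inj₂ (refl , noHead)

    freed-unmatched : ∀ t {a} → a ∈ freed t → mateA M a ≡ nothing
    freed-unmatched (toFree a Ma _) (here refl) = Ma

    freed-unique : ∀ t → Unique (freed t)
    freed-unique unmatched      = []
    freed-unique (toFree _ _ _) = [] ∷ []
    freed-unique (close _ _)    = []

    outside : Maybe (Fin n) → Fin n → Maybe (Fin m)
    outside nothing  b = mateB M b
    outside (just u) b with b ≟ u
    ... | yes _ = just a₀
    ... | no  _ = mateB M b

    outside-head : ∀ o {u} → o ≡ just u → outside o u ≡ just a₀
    outside-head (just u) refl with u ≟ u
    ... | yes _   = refl
    ... | no  u≢u = ⊥-elim (u≢u refl)

    outside-other : ∀ o {b} → o ≢ just b → outside o b ≡ mateB M b
    outside-other nothing  o≢b = refl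
    outside-other (just u) {b} o≢b with b ≟ u
    ... | yes refl = ⊥-elim (o≢b refl)
    ... | no  _    = refl

    outside-cases : ∀ o {b a} → outside o b ≡ just a → (o ≡ just b × a ≡ a₀) ⊎ (o ≢ just b × mateB M b ≡ just a)
    outside-cases nothing  eq = inj₂ ((λ ()) , eq)
    outside-cases (just u) {b} eq with b ≟ u
    ... | yes refl = inj₁ (refl , sym (just-injective eq))
    ... | no  b≢u  = inj₂ ((λ u≡b → b≢u (sym (just-injective u≡b))) , eq)

    successorMate : List (Fin n) → Maybe (Fin m)
    successorMate []      = lastMate tailEnd
    successorMate (y ∷ _) = just (partner y)

    rematch : List (Fin n) → Fin n → Maybe (Fin m)
    rematch []       b = outside headEnd b
    rematch (x ∷ xs) b with b ≟ x
    ... | yes _ = successorMate xs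
    ... | no  _ = rematch xs b

    rematch-≡ : ∀ x xs → rematch (x ∷ xs) x ≡ successorMate xs
    rematch-≡ x xs with x ≟ x
    ... | yes _   = refl
    ... | no  x≢x = ⊥-elim (x≢x refl)

    rematch-≢ : ∀ {x b} xs → b ≢ x → rematch (x ∷ xs) b ≡ rematch xs b
    rematch-≢ {x} {b} xs b≢x with b ≟ x
    ... | yes b≡x = ⊥-elim (b≢x b≡x)
    ... | no  _   = refl

    rematch-outside : ∀ xs {b} → b ∉ xs → rematch xs b ≡ outside headEnd b
    rematch-outside []       b∉ = refl
    rematch-outside (x ∷ xs) b∉ = trans (rematch-≢ xs (b∉ ∘ here)) (rematch-outside xs (b∉ ∘ there))

    rematch-consecutive : ∀ {xs b y} → Unique xs → Consecutive xs b y → rematch xs b ≡ just (partner y)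
    rematch-consecutive {x ∷ y ∷ ys} _ now = rematch-≡ x (y ∷ ys)
    rematch-consecutive {x ∷ xs} (x∉ ∷ uniq) (later c) =
      trans (rematch-≢ xs λ { refl → head∉tail (x∉ ∷ uniq) (Consecutive-∈₁ c) }) (rematch-consecutive uniq c)

    rematch-last : ∀ x xs → Unique (x ∷ xs) → rematch (x ∷ xs) (lastOf x xs) ≡ lastMate tailEnd
    rematch-last x []       _          = rematch-≡ x []
    rematch-last x (y ∷ ys) (x∉ ∷ uniq) =
      trans (rematch-≢ (y ∷ ys) λ last≡x → head∉tail (x∉ ∷ uniq) (subst (_∈ y ∷ ys) last≡x (lastOf-∈ y ys)))
        (rematch-last y ys uniq)

    data Rematched (b : Fin n) (a : Fin m) : Set where
      viaWalk   : ∀ {y} → Consecutive walk b y → partner y ≡ a → Rematched b a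
      viaLast   : b ≡ last → lastMate tailEnd ≡ just a → Rematched b a
      viaHead   : headEnd ≡ just b → a ≡ a₀ → Rematched b a
      unchanged : b ∉ walk → headEnd ≢ just b → mateB M b ≡ just a → Rematched b a

    rematch-cases : ∀ x xs {b a} → rematch (x ∷ xs) b ≡ just a →
      (∃ λ y → Consecutive (x ∷ xs) b y × partner y ≡ a)
      ⊎ (b ≡ lastOf x xs × lastMate tailEnd ≡ just a)
      ⊎ (b ∉ x ∷ xs × outside headEnd b ≡ just a)
    rematch-cases x xs {b} eq with b ≟ x
    rematch-cases x []       eq | yes refl = inj₂ (inj₁ (refl , eq))
    rematch-cases x (y ∷ ys) eq | yes refl = inj₁ (y , now , just-injective eq)
    rematch-cases x []       eq | no  b≢x  = inj₂ (inj₂ ((λ { (here b≡x) → b≢x b≡x ; (there ()) }) , eq))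
    rematch-cases x (y ∷ ys) eq | no  b≢x  with rematch-cases y ys eq
    ... | inj₁ (y' , c , p)      = inj₁ (y' , later c , p)
    ... | inj₂ (inj₁ atLast)     = inj₂ (inj₁ atLast)
    ... | inj₂ (inj₂ (b∉ , out)) = inj₂ (inj₂ ((λ { (here b≡x) → b≢x b≡x ; (there b∈) → b∉ b∈ }) , out))

    rematched : ∀ {b a} → rematch walk b ≡ just a → Rematched b a
    rematched eq with rematch-cases b₀ bs eq
    ... | inj₁ (_ , c , p)            = viaWalk c p
    ... | inj₂ (inj₁ (b≡last , l))    = viaLast b≡last l
    ... | inj₂ (inj₂ (b∉ , out)) with outside-cases headEnd out
    ...   | inj₁ (head≡b , a≡a₀) = viaHead head≡b a≡a₀
    ...   | inj₂ (head≢b , Mb)   = unchanged b∉ head≢b Mb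

    head-unmatched : ∀ {b} → headEnd ≡ just b → b ∉ walk
    head-unmatched head≡b b∈ = walk-matched b∈ (proj₁ (headEnd-free head≡b))

    private
      mateB≡a₀⇒∈walk : ∀ {b} → mateB M b ≡ just a₀ → b ∈ walk
      mateB≡a₀⇒∈walk Mb = subst (_∈ walk) (mateB-injective b₀a₀ Mb) (here refl)

      walk≢last : ∀ {b a y} → Consecutive walk b y → partner y ≡ a → lastMate tailEnd ≢ just a
      walk≢last c refl l with lastMate-cases tailEnd l
      ... | inj₁ a∈freed = nothing≢just (trans (sym (freed-unmatched tailEnd a∈freed)) (mateA-partner (Consecutive-∈₂ c)))
      ... | inj₂ (py≡a₀ , _) = partner-tail≢a₀ (Consecutive-∈tail c) py≡a₀

      walk≢head : ∀ {b y} → Consecutive walk b y → partner y ≢ a₀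
      walk≢head c = partner-tail≢a₀ (Consecutive-∈tail c)

      walk≢unchanged : ∀ {b b' y} → Consecutive walk b y → b' ∉ walk → mateB M b' ≢ just (partner y)
      walk≢unchanged c b'∉ Mb' = b'∉ (subst (_∈ walk) (mateB-injective (mateB-partner (Consecutive-∈₂ c)) Mb') (Consecutive-∈₂ c))

      last≢head : ∀ {b} → headEnd ≡ just b → lastMate tailEnd ≢ just a₀
      last≢head head≡b l with lastMate-cases tailEnd l
      ... | inj₁ a₀∈freed = nothing≢just (trans (sym (freed-unmatched tailEnd a₀∈freed)) mateA-a₀)
      ... | inj₂ (_ , noHead) with trans (sym noHead) head≡b
      ...   | ()

      last≢unchanged : ∀ {b a} → b ∉ walk → mateB M b ≡ just a → lastMate tailEnd ≢ just a
      last≢unchanged b∉ Mb l with lastMate-cases tailEnd l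
      ... | inj₁ a∈freed = nothing≢just (trans (sym (freed-unmatched tailEnd a∈freed)) (consBA M _ _ Mb))
      ... | inj₂ (refl , _) = b∉ (mateB≡a₀⇒∈walk Mb)

      head≢unchanged : ∀ {b} → b ∉ walk → mateB M b ≢ just a₀
      head≢unchanged b∉ Mb = b∉ (mateB≡a₀⇒∈walk Mb)

    rematched-injective : ∀ {b b' a} → Rematched b a → Rematched b' a → b ≡ b'
    rematched-injective (viaWalk c p) (viaWalk c' p') with
      mateB-injective (trans (mateB-partner (Consecutive-∈₂ c)) (cong just p)) (trans (mateB-partner (Consecutive-∈₂ c')) (cong just p'))
    ... | refl = Consecutive-injective unique c c'
    rematched-injective (viaWalk c p)     (viaLast _ l)         = ⊥-elim (walk≢last c p l)
    rematched-injective (viaWalk c refl)  (viaHead _ a≡a₀)      = ⊥-elim (walk≢head c a≡a₀)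
    rematched-injective (viaWalk c refl)  (unchanged b'∉ _ Mb') = ⊥-elim (walk≢unchanged c b'∉ Mb')
    rematched-injective (viaLast _ l)     (viaWalk c p)         = ⊥-elim (walk≢last c p l)
    rematched-injective (viaLast b≡ _)    (viaLast b'≡ _)       = trans b≡ (sym b'≡)
    rematched-injective (viaLast _ l)     (viaHead h refl)      = ⊥-elim (last≢head h l)
    rematched-injective (viaLast _ l)     (unchanged b'∉ _ Mb') = ⊥-elim (last≢unchanged b'∉ Mb' l)
    rematched-injective (viaHead _ a≡a₀)  (viaWalk c refl)      = ⊥-elim (walk≢head c a≡a₀)
    rematched-injective (viaHead h refl)  (viaLast _ l)         = ⊥-elim (last≢head h l)
    rematched-injective (viaHead h _)     (viaHead h' _)        = just-injective (trans (sym h) h')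
    rematched-injective (viaHead _ refl)  (unchanged b'∉ _ Mb') = ⊥-elim (head≢unchanged b'∉ Mb')
    rematched-injective (unchanged b∉ _ Mb) (viaWalk c refl)    = ⊥-elim (walk≢unchanged c b∉ Mb)
    rematched-injective (unchanged b∉ _ Mb) (viaLast _ l)       = ⊥-elim (last≢unchanged b∉ Mb l)
    rematched-injective (unchanged b∉ _ Mb) (viaHead _ refl)    = ⊥-elim (head≢unchanged b∉ Mb)
    rematched-injective (unchanged _ _ Mb)  (unchanged _ _ Mb') = mateB-injective Mb Mb'

    rematched-edge : ∀ {b a} → Rematched b a → E a b ≡ true
    rematched-edge (viaWalk c refl) with Consecutive⇒⟵ linked c
    ... | _ , My , ab , _ = subst (λ a → E a _ ≡ true) (sym (partner-≡ My)) ab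
    rematched-edge (viaLast refl l)   = lastMate-edge tailEnd l
    rematched-edge (viaHead h refl)   = proj₂ (headEnd-free h)
    rematched-edge (unchanged _ _ Mb) = inE M _ _ (consBA M _ _ Mb)

    rematch-injective : ∀ {b b' a} → rematch walk b ≡ just a → rematch walk b' ≡ just a → b ≡ b'
    rematch-injective eq eq' = rematched-injective (rematched eq) (rematched eq')

    rematch-edge : ∀ {b a} → rematch walk b ≡ just a → E a b ≡ true
    rematch-edge = rematched-edge ∘ rematched

    open MatchingFromMateB G (rematch walk) rematch-injective rematch-edge public renaming (matching to N)

    mateA-N-partner : ∀ {b y} → Consecutive walk b y → mateA N (partner y) ≡ just b
    mateA-N-partner c = inverse-complete (rematch-consecutive unique c)

    mateB-N-last : mateB N last ≡ lastMate tailEnd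
    mateB-N-last = rematch-last b₀ bs unique

    mateB-N-head : ∀ {u} → headEnd ≡ just u → mateB N u ≡ just a₀
    mateB-N-head head≡u = trans (rematch-outside walk (head-unmatched head≡u)) (outside-head headEnd head≡u)

    mateB-N-unchanged : ∀ {b} → b ∉ walk → headEnd ≢ just b → mateB N b ≡ mateB M b
    mateB-N-unchanged b∉ head≢b = trans (rematch-outside walk b∉) (outside-other headEnd head≢b)

    a₀∈partners : a₀ ∈ map partner walk
    a₀∈partners = subst (_∈ map partner walk) (partner-≡ b₀a₀) (∈-map⁺ partner (here refl))

    mateA-N-unchanged : ∀ {a} → a ∉ map partner walk → a ∉ freed tailEnd → mateA N a ≡ mateA M a
    mateA-N-unchanged {a} a∉ a∉freed with mateA M a in Ma
    ... | just b = inverse-complete (trans (mateB-N-unchanged b∉ head≢b) (consAB M a b Ma))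
      where
      b∉ : b ∉ walk
      b∉ b∈ = a∉ (subst (_∈ map partner walk) (partner-≡ (consAB M a b Ma)) (∈-map⁺ partner b∈))
      head≢b : headEnd ≢ just b
      head≢b head≡b = nothing≢just (trans (sym (proj₁ (headEnd-free head≡b))) (consAB M a b Ma))
    ... | nothing = inverse-nothing (λ b eq → never (rematched {b} eq))
      where
      never : ∀ {b} → Rematched b a → ⊥
      never (viaWalk c refl)   = a∉ (∈-map⁺ partner (Consecutive-∈₂ c))
      never (viaLast _ l) with lastMate-cases tailEnd l
      ... | inj₁ a∈freed = a∉freed a∈freed
      ... | inj₂ (refl , _) = a∉ a₀∈partners
      never (viaHead _ refl)   = a∉ a₀∈partners
      never (unchanged _ _ Mb) = nothing≢just (trans (sym Ma) (consBA M a _ Mb))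

    fromMaybe-∈ : ∀ {X : Set} {x : X} o → x ∈ fromMaybe o → o ≡ just x
    fromMaybe-∈ (just _) (here refl) = refl

    fromMaybe-unique : ∀ {X : Set} (o : Maybe X) → Unique (fromMaybe o)
    fromMaybe-unique nothing  = []
    fromMaybe-unique (just _) = [] ∷ []

    changedB : List (Fin n)
    changedB = walk ++ fromMaybe headEnd

    changedA : List (Fin m)
    changedA = map partner walk ++ freed tailEnd

    changedB-unique : Unique changedB
    changedB-unique = Unique.++⁺ unique (fromMaybe-unique headEnd)
      (λ (b∈ , b∈head) → head-unmatched (fromMaybe-∈ headEnd b∈head) b∈)

    changedA-unique : Unique changedA
    changedA-unique = Unique.++⁺
      (map⁺-injectiveOn partner walk
        (λ y∈ y'∈ py≡py' → mateB-injective (mateB-partner y∈) (trans (mateB-partner y'∈) (cong just (sym py≡py'))))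
        unique)
      (freed-unique tailEnd)
      (λ (a∈ , a∈freed) → let y , y∈ , a≡py = ∈-map⁻ partner a∈ in
        nothing≢just (trans (sym (freed-unmatched tailEnd a∈freed)) (trans (cong (mateA M) a≡py) (mateA-partner y∈))))

    unchangedB : ∀ b → b ∉ changedB → mateB N b ≡ mateB M b
    unchangedB b b∉ = mateB-N-unchanged (b∉ ∘ ∈-++⁺ˡ)
      (λ head≡b → b∉ (∈-++⁺ʳ walk (subst (λ o → b ∈ fromMaybe o) (sym head≡b) (here refl))))

    unchangedA : ∀ a → a ∉ changedA → mateA N a ≡ mateA M a
    unchangedA a a∉ = mateA-N-unchanged (a∉ ∘ ∈-++⁺ˡ) (a∉ ∘ ∈-++⁺ʳ (map partner walk))

    walkVotes : List (Fin n) → ℤ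
    walkVotes = sumₗ (λ z → voteB N z + voteA N (partner z))

    endVotes : ℤ
    endVotes = sumₗ (voteA N) (freed tailEnd) + sumₗ (voteB N) (fromMaybe headEnd)

    φ-difference-switch : + φ G N M - + φ G M N ≡ walkVotes walk + endVotes
    φ-difference-switch = begin
      + φ G N M - + φ G M N
        ≡⟨ φ-difference N ⟩
      sum (voteA N) + sum (voteB N)
        ≡⟨ cong₂ _+_ (sum-support (voteA N) changedA changedA-unique (λ a a∉ → voteA-unchanged N (unchangedA a a∉)))
                     (sum-support (voteB N) changedB changedB-unique (λ b b∉ → voteB-unchanged N (unchangedB b b∉))) ⟩
      sumₗ (voteA N) changedA + sumₗ (voteB N) changedB
        ≡⟨ cong₂ _+_ (trans (sumₗ-++ (voteA N) (map partner walk) (freed tailEnd))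
                            (cong (_+ ΣfreedA) (sumₗ-map (voteA N) partner walk)))
                     (sumₗ-++ (voteB N) walk (fromMaybe headEnd)) ⟩
      (ΣwalkA + ΣfreedA) + (ΣwalkB + ΣheadB)
        ≡⟨ interchange ΣwalkA ΣfreedA ΣwalkB ΣheadB ⟩
      (ΣwalkB + ΣwalkA) + endVotes
        ≡⟨ cong (_+ endVotes) (sym (sumₗ-distrib-+ (voteB N) (voteA N ∘ partner) walk)) ⟩
      walkVotes walk + endVotes ∎
      where
      open ≡-Reasoning
      ΣwalkA = sumₗ (voteA N ∘ partner) walk
      ΣwalkB = sumₗ (voteB N) walk
      ΣfreedA = sumₗ (voteA N) (freed tailEnd)
      ΣheadB = sumₗ (voteB N) (fromMaybe headEnd)
      interchange : ∀ w x y z → (w + x) + (y + z) ≡ (y + w) + (x + z)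
      interchange = solve 4 (λ w x y z → (w :+ x) :+ (y :+ z) := (y :+ w) :+ (x :+ z)) refl

    size-difference-switch : + size G N - + size G M ≡ sizeChange N a₀ + sumₗ (sizeChange N) (freed tailEnd)
    size-difference-switch = begin
      + size G N - + size G M
        ≡⟨ size-difference N ⟩
      sum (sizeChange N)
        ≡⟨ sum-support (sizeChange N) changedA changedA-unique (λ a a∉ → sizeChange-unchanged N (unchangedA a a∉)) ⟩
      sumₗ (sizeChange N) changedA
        ≡⟨ sumₗ-++ (sizeChange N) (map partner walk) (freed tailEnd) ⟩
      sumₗ (sizeChange N) (map partner walk) + sumₗ (sizeChange N) (freed tailEnd)
        ≡⟨ cong (_+ sumₗ (sizeChange N) (freed tailEnd)) (trans (sumₗ-map (sizeChange N) partner walk) walk-size) ⟩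
      sizeChange N a₀ + sumₗ (sizeChange N) (freed tailEnd) ∎
      where
      open ≡-Reasoning
      tail-unchanged : ∀ {y} → y ∈ bs → sizeChange N (partner y) ≡ + 0
      tail-unchanged y∈bs with Consecutive-pred {z = b₀} y∈bs
      ... | _ , c rewrite mateA-N-partner c | mateA-partner (there y∈bs) = refl
      walk-size : sumₗ (sizeChange N ∘ partner) walk ≡ sizeChange N a₀
      walk-size = begin
        sizeChange N (partner b₀) + sumₗ (sizeChange N ∘ partner) bs
          ≡⟨ cong₂ _+_ (cong (sizeChange N) (partner-≡ b₀a₀)) (sumₗ-zero _ bs tail-unchanged) ⟩
        sizeChange N a₀ + + 0
          ≡⟨ ℤP.+-identityʳ _ ⟩
        sizeChange N a₀ ∎

    walkVotes-bound : ∀ x xs → (∀ {b y} → Consecutive (x ∷ xs) b y → Consecutive walk b y) →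
      (walkWt (x ∷ xs) + walkWt (x ∷ xs)) + (voteB N (lastOf x xs) + voteA N (partner x)) ≤ walkVotes (x ∷ xs)
    walkVotes-bound x [] _ = ℤP.≤-reflexive (trans (ℤP.+-identityˡ votes) (sym (ℤP.+-identityʳ votes)))
      where votes = voteB N x + voteA N (partner x)
    walkVotes-bound x (y ∷ ys) suffix = begin
      ((arcWt y x + W) + (arcWt y x + W)) + (Bℓ + Ax)
        ≡⟨ cong (λ r → ((r + W) + (r + W)) + (Bℓ + Ax)) (arcWt-≡ x (mateB-partner (Consecutive-∈₂ c))) ⟩
      ((ρ + W) + (ρ + W)) + (Bℓ + Ax)
        ≡⟨ regroup ρ W Bℓ Ax ⟩
      (ρ + ρ) + ((W + W) + (Bℓ + Ax))
        ≤⟨ ℤP.+-monoˡ-≤ ((W + W) + (Bℓ + Ax)) new-edge ⟩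
      (Ay + Bx) + ((W + W) + (Bℓ + Ax))
        ≡⟨ shift Ay Bx (W + W) Bℓ Ax ⟩
      (Bx + Ax) + ((W + W) + (Bℓ + Ay))
        ≤⟨ ℤP.+-monoʳ-≤ (Bx + Ax) (walkVotes-bound y ys (suffix ∘ later)) ⟩
      (Bx + Ax) + walkVotes (y ∷ ys) ∎
      where
      open ℤP.≤-Reasoning
      c : Consecutive walk x y
      c = suffix now
      W = walkWt (y ∷ ys)
      ρ = halfWt (partner y) x
      Bℓ = voteB N (lastOf y ys)
      Ax = voteA N (partner x)
      Ay = voteA N (partner y)
      Bx = voteB N x
      regroup : ∀ r w p q → ((r + w) + (r + w)) + (p + q) ≡ (r + r) + ((w + w) + (p + q))
      regroup = solve 4 (λ r w p q → ((r :+ w) :+ (r :+ w)) :+ (p :+ q) := (r :+ r) :+ ((w :+ w) :+ (p :+ q))) refl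
      shift : ∀ s t w p q → (s + t) + (w + (p + q)) ≡ (t + q) + (w + (p + s))
      shift = solve 5 (λ s t w p q → (s :+ t) :+ (w :+ (p :+ q)) := (t :+ q) :+ (w :+ (p :+ s))) refl
      new-edge : ρ + ρ ≤ Ay + Bx
      new-edge = 2·halfWt≤votes N (mateA-N-partner c) (rematch-consecutive unique c)
        (mateA-partner (Consecutive-∈₂ c)) (mateB-partner (Consecutive-∈₁ c))
        (rematched-edge (viaWalk c refl))

    same-size : + size G N - + size G M ≡ + 0 → size G N ≡ size G M
    same-size diff≡0 = ℤP.+-injective (ℤP.i-j≡0⇒i≡j _ _ diff≡0)

    switch-bound : IsPopularMaxMatching G M → size G N ≡ size G M →
      (walkWt walk + walkWt walk) + ((voteB N last + voteA N a₀) + endVotes) ≤ + 0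
    switch-bound (maximum , popular) sizes≡ = begin
      (walkWt walk + walkWt walk) + ((voteB N last + voteA N a₀) + endVotes)
        ≡⟨ sym (ℤP.+-assoc (walkWt walk + walkWt walk) _ endVotes) ⟩
      ((walkWt walk + walkWt walk) + (voteB N last + voteA N a₀)) + endVotes
        ≤⟨ ℤP.+-monoˡ-≤ endVotes
             (subst (λ a → (walkWt walk + walkWt walk) + (voteB N last + voteA N a) ≤ walkVotes walk)
               (partner-≡ b₀a₀) (walkVotes-bound b₀ bs (λ c → c))) ⟩
      walkVotes walk + endVotes
        ≡⟨ sym φ-difference-switch ⟩
      + φ G N M - + φ G M N
        ≤⟨ ℤP.i≤j⇒i-j≤0 (ℤ.+≤+ (popular N N-maximum)) ⟩
      + 0 ∎
      where
      open ℤP.≤-Reasoning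
      N-maximum : IsMaximum G N
      N-maximum N' = subst (size G N' ℕ.≤_) (sym sizes≡) (maximum N')

    open-walk-bound : IsPopularMaxMatching G M → size G N ≡ size G M → endVotes ≡ + 1 → walkWt walk ≤ + 0
    open-walk-bound popularM sizes≡ ends≡1 = x+x≤1⇒x≤0 (walkWt walk) (ℤP.i-j≤0⇒i≤j (begin
      (walkWt walk + walkWt walk) + (-[1+ 1 ] + + 1)
        ≤⟨ ℤP.+-monoʳ-≤ (walkWt walk + walkWt walk)
             (ℤP.+-mono-≤ (ℤP.+-mono-≤ (voteB≥-1 N last) (voteA≥-1 N a₀)) (ℤP.≤-reflexive (sym ends≡1))) ⟩
      (walkWt walk + walkWt walk) + ((voteB N last + voteA N a₀) + endVotes)
        ≤⟨ switch-bound popularM sizes≡ ⟩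
      + 0 ∎))
      where open ℤP.≤-Reasoning

    closed-walk-bound : IsPopularMaxMatching G M → size G N ≡ size G M → endVotes ≡ + 0 →
      mateA N a₀ ≡ just last → E a₀ last ≡ true → walkWt walk + halfWt a₀ last ≤ + 0
    closed-walk-bound popularM sizes≡ ends≡0 Na₀ a₀-last = x+x≤1⇒x≤0 (walkWt walk + halfWt a₀ last) (begin
      (w + ρ) + (w + ρ)
        ≡⟨ regroup w ρ ⟩
      (w + w) + ((ρ + ρ) + + 0)
        ≤⟨ ℤP.+-monoʳ-≤ (w + w) (ℤP.+-mono-≤ new-edge (ℤP.≤-reflexive (sym ends≡0))) ⟩
      (w + w) + ((voteB N last + voteA N a₀) + endVotes)
        ≤⟨ switch-bound popularM sizes≡ ⟩
      + 0
        ≤⟨ ℤ.+≤+ ℕ.z≤n ⟩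
      + 1 ∎)
      where
      open ℤP.≤-Reasoning
      w = walkWt walk
      ρ = halfWt a₀ last
      regroup : ∀ w r → (w + r) + (w + r) ≡ (w + w) + ((r + r) + + 0)
      regroup = solve 2 (λ w r → (w :+ r) :+ (w :+ r) := (w :+ w) :+ ((r :+ r) :+ con (+ 0))) refl
      new-edge : ρ + ρ ≤ voteB N last + voteA N a₀
      new-edge = subst (ρ + ρ ≤_) (ℤP.+-comm (voteA N a₀) (voteB N last))
        (2·halfWt≤votes N Na₀ (inverse-sound Na₀) mateA-a₀ (mateB-partner (lastOf-∈ b₀ bs)) a₀-last)

    mateA-N-a₀-nothing : headEnd ≡ nothing → lastMate tailEnd ≢ just a₀ → mateA N a₀ ≡ nothing
    mateA-N-a₀-nothing noHead last≢a₀ = inverse-nothing (λ b eq → never (rematched {b} eq))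
      where
      never : ∀ {b} → Rematched b a₀ → ⊥
      never (viaWalk c p)       = partner-tail≢a₀ (Consecutive-∈tail c) p
      never (viaLast _ l)       = last≢a₀ l
      never (viaHead head≡b _)  = nothing≢just (trans (sym noHead) head≡b)
      never (unchanged b∉ _ Mb) = b∉ (mateB≡a₀⇒∈walk Mb)

  freeHead : ∀ {a₀ u} → mateB M u ≡ nothing → E a₀ u ≡ true →
    ∀ {u'} → just u ≡ just u' → mateB M u' ≡ nothing × E a₀ u' ≡ true
  freeHead Mu a₀u refl = Mu , a₀u

  module _ (popularM : IsPopularMaxMatching G M) {b₀ bs a₀} (b₀a₀ : mateB M b₀ ≡ just a₀)
    (unique : Unique (b₀ ∷ bs)) (linked : Linked _⟵_ (b₀ ∷ bs)) where

    simpleCycle≤0 : E a₀ (lastOf b₀ bs) ≡ true → walkWt (b₀ ∷ bs) + halfWt a₀ (lastOf b₀ bs) ≤ + 0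
    simpleCycle≤0 a₀-last = closed-walk-bound popularM (same-size sizes≡) refl Na₀ a₀-last
      where
      open Along b₀ bs a₀ b₀a₀ unique linked nothing (λ ()) (close refl a₀-last)
      Na₀ : mateA N a₀ ≡ just last
      Na₀ = inverse-complete mateB-N-last
      sizes≡ : + size G N - + size G M ≡ + 0
      sizes≡ = trans size-difference-switch (cong (_+ + 0) (sizeChange-≡ N Na₀ mateA-a₀))

    simpleWalkFromFreeA≤0 : ∀ {a} → mateA M a ≡ nothing → E a (lastOf b₀ bs) ≡ true → walkWt (b₀ ∷ bs) ≤ + 0
    simpleWalkFromFreeA≤0 {a} Ma a-last = open-walk-bound popularM (same-size sizes≡) ends≡1
      where
      open Along b₀ bs a₀ b₀a₀ unique linked nothing (λ ()) (toFree a Ma a-last)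
      Na : mateA N a ≡ just last
      Na = inverse-complete mateB-N-last
      Na₀ : mateA N a₀ ≡ nothing
      Na₀ = mateA-N-a₀-nothing refl λ { refl → nothing≢just (trans (sym Ma) mateA-a₀) }
      sizes≡ : + size G N - + size G M ≡ + 0
      sizes≡ = trans size-difference-switch (cong₂ (λ x y → x + (y + + 0)) (sizeChange-≡ N Na₀ mateA-a₀) (sizeChange-≡ N Na Ma))
      ends≡1 : endVotes ≡ + 1
      ends≡1 = cong (λ v → (v + + 0) + + 0) (voteA-gain N Na Ma)

    simpleWalkToFreeB≤0 : ∀ {u} → mateB M u ≡ nothing → E a₀ u ≡ true → walkWt (b₀ ∷ bs) ≤ + 0
    simpleWalkToFreeB≤0 {u} Mu a₀u = open-walk-bound popularM (same-size sizes≡) ends≡1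
      where
      open Along b₀ bs a₀ b₀a₀ unique linked (just u) (freeHead Mu a₀u) unmatched
      Na₀ : mateA N a₀ ≡ just u
      Na₀ = inverse-complete (mateB-N-head refl)
      sizes≡ : + size G N - + size G M ≡ + 0
      sizes≡ = trans size-difference-switch (cong (_+ + 0) (sizeChange-≡ N Na₀ mateA-a₀))
      ends≡1 : endVotes ≡ + 1
      ends≡1 = cong (λ v → + 0 + (v + + 0)) (voteB-gain N (mateB-N-head refl) Mu)

    no-augmenting-walk : ∀ {a u} → mateA M a ≡ nothing → E a (lastOf b₀ bs) ≡ true →
      mateB M u ≡ nothing → E a₀ u ≡ true → ⊥
    no-augmenting-walk {a} {u} Ma a-last Mu a₀u = one≰zero (subst (_≤ + 0) gain (ℤP.i≤j⇒i-j≤0 (ℤ.+≤+ (proj₁ popularM N))))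
      where
      open Along b₀ bs a₀ b₀a₀ unique linked (just u) (freeHead Mu a₀u) (toFree a Ma a-last)
      Na : mateA N a ≡ just last
      Na = inverse-complete mateB-N-last
      Na₀ : mateA N a₀ ≡ just u
      Na₀ = inverse-complete (mateB-N-head refl)
      gain : + size G N - + size G M ≡ + 1
      gain = trans size-difference-switch (cong₂ (λ x y → x + (y + + 0)) (sizeChange-≡ N Na₀ mateA-a₀) (sizeChange-≡ N Na Ma))
      one≰zero : ¬ (+ 1 ≤ + 0)
      one≰zero (ℤ.+≤+ ())

module Potential {m n : ℕ} (G : PrefGraph m n) (M : Matching G) (popularM : IsPopularMaxMatching G M) where

  open PrefGraph G
  open MatchingFacts G M
  open Switching G M
  open ListFacts
  open OptionalMaximum
  open IntegerFacts using (⟦_⟧; count≡sum; sum-mono-≤)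
  open ℤSum using (sum; sum-cong-≗; sumₗ; sumₗ-cong; sum-support)
  open MatchedSums ℤP.+-0-isCommutativeMonoid G M using (atMate; sum-matchedB)
  open import Data.Fin using (_≟_)
  open import Data.Fin.Properties using (any?)
  import Data.Bool as Bool
  open import Data.Bool using (false; if_then_else_)
  open import Data.Maybe.Properties using (≡-dec)
  open import Data.Integer as ℤ using (ℤ; +_; _+_; _≤_)
  open import Data.Integer.Solver using (module +-*-Solver)
  open +-*-Solver using (solve; _:+_; _:=_)
  open import Data.List using (List; []; _∷_; _++_; length)
  open import Data.List.Membership.Propositional using (_∈_; _∉_)
  open import Data.List.Membership.DecPropositional (_≟_ {n = n}) using (_∈?_)
  open import Data.List.Relation.Unary.All using (All; []; _∷_; lookup)
  open import Data.List.Relation.Unary.Unique.Propositional using (Unique)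
  open import Data.List.Relation.Unary.Linked using (Linked; [-]; _∷_)
  open import Data.Product using (proj₁; proj₂)
  open import Data.Sum using (inj₁; inj₂)
  open import Data.Empty using (⊥-elim)
  open import Relation.Nullary using (¬_; Dec; yes; no; does)
  open import Relation.Nullary.Decidable using (_×-dec_)
  open import Relation.Binary.PropositionalEquality

  K : ℕ
  K = size G M

  NearFreeA : Fin n → Set
  NearFreeA b = ∃ λ a → mateA M a ≡ nothing × E a b ≡ true

  nearFreeA? : ∀ b → Dec (NearFreeA b)
  nearFreeA? b = any? (λ a → ≡-dec _≟_ (mateA M a) nothing ×-dec (E a b Bool.≟ true))

  PartnerNearFreeB : Fin n → Set
  PartnerNearFreeB b = Σ (Fin m) λ a → mateB M b ≡ just a × ∃ λ u → mateB M u ≡ nothing × E a u ≡ true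

  -- Walks starting in Nbr(U_A) get the head start n₀ − 1 that condition (ii) asks for.
  startValue : Fin n → ℤ
  startValue b with nearFreeA? b
  ... | yes _ = + (K ∸ 1)
  ... | no  _ = + 0

  startValue-nearFreeA : ∀ {b} → NearFreeA b → startValue b ≡ + (K ∸ 1)
  startValue-nearFreeA {b} near with nearFreeA? b
  ... | yes _   = refl
  ... | no  far = ⊥-elim (far near)

  startValue-far : ∀ {b} → ¬ NearFreeA b → startValue b ≡ + 0
  startValue-far {b} far with nearFreeA? b
  ... | yes near = ⊥-elim (far near)
  ... | no  _    = refl

  0≤startValue : ∀ b → + 0 ≤ startValue b
  0≤startValue b with nearFreeA? b
  ... | yes _ = ℤ.+≤+ ℕ.z≤n
  ... | no  _ = ℤP.≤-refl

  startValue≤K-1 : ∀ b → startValue b ≤ + (K ∸ 1)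
  startValue≤K-1 b with nearFreeA? b
  ... | yes _ = ℤP.≤-refl
  ... | no  _ = ℤ.+≤+ ℕ.z≤n

  walkValue : List (Fin n) → ℤ
  walkValue []       = + 0
  walkValue (x ∷ xs) = walkWt (x ∷ xs) + startValue (lastOf x xs)

  walkValue-∷ : ∀ x y ys → walkValue (x ∷ y ∷ ys) ≡ arcWt y x + walkValue (y ∷ ys)
  walkValue-∷ x y ys = ℤP.+-assoc (arcWt y x) (walkWt (y ∷ ys)) (startValue (lastOf y ys))

  walkWt-++ : ∀ xs y ys → walkWt (xs ++ y ∷ ys) ≡ walkWt (xs ++ y ∷ []) + walkWt (y ∷ ys)
  walkWt-++ []            y ys = sym (ℤP.+-identityˡ _)
  walkWt-++ (x ∷ [])      y ys = cong (_+ walkWt (y ∷ ys)) (sym (ℤP.+-identityʳ (arcWt y x)))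
  walkWt-++ (x ∷ x' ∷ xs) y ys = trans (cong (_+_ (arcWt x' x)) (walkWt-++ (x' ∷ xs) y ys))
    (sym (ℤP.+-assoc (arcWt x' x) (walkWt (x' ∷ xs ++ y ∷ [])) (walkWt (y ∷ ys))))

  walkWt-cut : ∀ P y Q R → walkWt (P ++ y ∷ Q ++ y ∷ R) ≡ walkWt (P ++ y ∷ R) + walkWt (y ∷ Q ++ y ∷ [])
  walkWt-cut P y Q R = begin
    walkWt (P ++ y ∷ Q ++ y ∷ R)        ≡⟨ walkWt-++ P y (Q ++ y ∷ R) ⟩
    front + walkWt (y ∷ Q ++ y ∷ R)     ≡⟨ cong (_+_ front) (walkWt-++ (y ∷ Q) y R) ⟩
    front + (loop + back)               ≡⟨ swap front loop back ⟩
    (front + back) + loop               ≡⟨ cong (_+ loop) (sym (walkWt-++ P y R)) ⟩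
    walkWt (P ++ y ∷ R) + loop          ∎
    where
    open ≡-Reasoning
    front = walkWt (P ++ y ∷ [])
    loop  = walkWt (y ∷ Q ++ y ∷ [])
    back  = walkWt (y ∷ R)
    swap : ∀ p l r → p + (l + r) ≡ (p + r) + l
    swap = solve 3 (λ p l r → p :+ (l :+ r) := (p :+ r) :+ l) refl

  closedWalk≤0 : ∀ fuel x xs → length xs ℕ.≤ fuel → Linked _⟵_ (x ∷ xs) → lastOf x xs ≡ x → walkWt (x ∷ xs) ≤ + 0
  closedWalk≤0 _ x [] _ _ _ = ℤP.≤-refl
  closedWalk≤0 fuel x (k ∷ ks) _ ((a₀ , Mk , a₀x , _) ∷ linked) closed with unique⊎loop _≟_ (k ∷ ks)
  ... | inj₁ uniq = subst (_≤ + 0) (trans (ℤP.+-comm (walkWt (k ∷ ks)) (halfWt a₀ (lastOf k ks)))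
                      (cong (_+ walkWt (k ∷ ks)) (trans (cong (halfWt a₀) closed) (sym (arcWt-≡ x Mk)))))
                      (simpleCycle≤0 popularM Mk uniq linked (subst (λ b → E a₀ b ≡ true) (sym closed) a₀x))
  closedWalk≤0 (ℕ.suc fuel) x (k ∷ ks) len≤ (arc ∷ linked) closed | inj₂ ((P , y , Q , R) , ks≡) = begin
    walkWt (x ∷ k ∷ ks)                                    ≡⟨ cong (walkWt ∘ (x ∷_)) ks≡ ⟩
    walkWt ((x ∷ P) ++ y ∷ Q ++ y ∷ R)                     ≡⟨ walkWt-cut (x ∷ P) y Q R ⟩
    walkWt (x ∷ P ++ y ∷ R) + walkWt (y ∷ Q ++ y ∷ [])    ≤⟨ ℤP.+-mono-≤ rest≤0 loop≤0 ⟩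
    + 0 ∎
    where
    open ℤP.≤-Reasoning
    pieces : Linked _⟵_ (x ∷ P ++ y ∷ R) × Linked _⟵_ (y ∷ Q ++ y ∷ [])
    pieces = Linked-cut (x ∷ P) Q (subst (Linked _⟵_ ∘ (x ∷_)) ks≡ (arc ∷ linked))
    shorter : ∀ (xs : List (Fin n)) → length xs ℕ.< length (P ++ y ∷ Q ++ y ∷ R) → length xs ℕ.≤ fuel
    shorter _ lt = ℕP.<⇒≤pred (ℕP.<-≤-trans lt (subst (λ ys → length ys ℕ.≤ ℕ.suc fuel) ks≡ len≤))
    rest≤0 : walkWt (x ∷ P ++ y ∷ R) ≤ + 0
    rest≤0 = closedWalk≤0 fuel x (P ++ y ∷ R) (shorter (P ++ y ∷ R) (length-cut< P Q y R)) (proj₁ pieces)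
      (trans (sym (lastOf-cut x P y Q R)) (trans (cong (lastOf x) (sym ks≡)) closed))
    loop≤0 : walkWt (y ∷ Q ++ y ∷ []) ≤ + 0
    loop≤0 = closedWalk≤0 fuel y (Q ++ y ∷ []) (shorter (Q ++ y ∷ []) (length-loop< P Q y R)) (proj₂ pieces) (lastOf-++ y Q y [])

  regroup : ∀ {w s s'} w' l → w ≡ w' + l → s ≡ s' → w + s ≡ (w' + s') + l
  regroup {s' = s'} w' l refl refl = swap w' l s'
    where
    swap : ∀ w l s → (w + l) + s ≡ (w + s) + l
    swap = solve 3 (λ w l s → (w :+ l) :+ s := (w :+ s) :+ l) refl

  walkValue-cut : ∀ P y Q R → walkValue (P ++ y ∷ Q ++ y ∷ R) ≡ walkValue (P ++ y ∷ R) + walkWt (y ∷ Q ++ y ∷ [])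
  walkValue-cut []      y Q R = regroup (walkWt (y ∷ R)) (walkWt (y ∷ Q ++ y ∷ []))
    (walkWt-cut [] y Q R) (cong startValue (lastOf-++ y Q y R))
  walkValue-cut (p ∷ P) y Q R = regroup (walkWt (p ∷ P ++ y ∷ R)) (walkWt (y ∷ Q ++ y ∷ []))
    (walkWt-cut (p ∷ P) y Q R) (cong startValue (lastOf-cut p P y Q R))

  simplify : ∀ fuel b r → length r ℕ.≤ fuel → Linked _⟵_ (b ∷ r) →
    ∃ λ r' → Linked _⟵_ (b ∷ r') × Unique (b ∷ r') × walkValue (b ∷ r) ≤ walkValue (b ∷ r')
  simplify fuel b r _ linked with unique⊎loop _≟_ (b ∷ r)
  ... | inj₁ uniq = r , linked , uniq , ℤP.≤-refl
  simplify ℕ.zero b r len≤ linked | inj₂ ((P , y , Q , R) , b∷r≡) with cut-head P y Q R b∷r≡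
  ... | _ , _ , lt = ⊥-elim (ℕP.n≮0 (ℕP.<-≤-trans lt len≤))
  simplify (ℕ.suc fuel) b r len≤ linked | inj₂ ((P , y , Q , R) , b∷r≡) with cut-head P y Q R b∷r≡
  ... | r' , cut≡ , lt with simplify fuel b r' (ℕP.<⇒≤pred (ℕP.<-≤-trans lt len≤))
                             (subst (Linked _⟵_) cut≡ (proj₁ (Linked-cut P Q (subst (Linked _⟵_) b∷r≡ linked))))
  ...   | r'' , linked'' , uniq'' , step = r'' , linked'' , uniq'' , ℤP.≤-trans cut-value step
    where
    open ℤP.≤-Reasoning
    pieces : Linked _⟵_ (P ++ y ∷ R) × Linked _⟵_ (y ∷ Q ++ y ∷ [])
    pieces = Linked-cut P Q (subst (Linked _⟵_) b∷r≡ linked)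
    loop≤0 : walkWt (y ∷ Q ++ y ∷ []) ≤ + 0
    loop≤0 = closedWalk≤0 (length (Q ++ y ∷ [])) y (Q ++ y ∷ []) ℕP.≤-refl (proj₂ pieces) (lastOf-++ y Q y [])
    cut-value : walkValue (b ∷ r) ≤ walkValue (b ∷ r')
    cut-value = begin
      walkValue (b ∷ r)                                          ≡⟨ cong walkValue b∷r≡ ⟩
      walkValue (P ++ y ∷ Q ++ y ∷ R)                            ≡⟨ walkValue-cut P y Q R ⟩
      walkValue (P ++ y ∷ R) + walkWt (y ∷ Q ++ y ∷ [])          ≤⟨ ℤP.+-monoʳ-≤ (walkValue (P ++ y ∷ R)) loop≤0 ⟩
      walkValue (P ++ y ∷ R) + + 0                               ≡⟨ ℤP.+-identityʳ _ ⟩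
      walkValue (P ++ y ∷ R)                                     ≡⟨ cong walkValue cut≡ ⟩
      walkValue (b ∷ r') ∎

  matchedB-count : sum (λ b → ⟦ isJust (mateB M b) ⟧) ≡ + K
  matchedB-count = begin
    sum (λ b → ⟦ isJust (mateB M b) ⟧)                   ≡⟨ sum-cong-≗ (λ b → ⟦⟧≡if (isJust (mateB M b))) ⟩
    sum (λ b → if isJust (mateB M b) then + 1 else + 0)  ≡⟨ sum-matchedB (λ _ → + 1) ⟩
    sum (λ a → atMate (λ _ → + 1) (mateA M a))           ≡⟨ sum-cong-≗ (λ a → atMate-one (mateA M a)) ⟩
    sum (λ a → ⟦ isJust (mateA M a) ⟧)                   ≡⟨ sym (count≡sum (λ a → isJust (mateA M a))) ⟩
    + K                                                  ∎
    where
    open ≡-Reasoning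
    ⟦⟧≡if : ∀ t → ⟦ t ⟧ ≡ (if t then + 1 else + 0)
    ⟦⟧≡if true  = refl
    ⟦⟧≡if false = refl
    atMate-one : ∀ o → atMate (λ _ → + 1) o ≡ ⟦ isJust o ⟧
    atMate-one (just _) = refl
    atMate-one nothing  = refl

  unique-matched≤K : ∀ xs → Unique xs → All (MatchedB G M) xs → length xs ℕ.≤ K
  unique-matched≤K xs uniq matched = ℤP.drop‿+≤+ (begin
    + length xs                         ≡⟨ sym (sumₗ-one xs) ⟩
    sumₗ (λ _ → + 1) xs                 ≡⟨ sym (sumₗ-cong xs member) ⟩
    sumₗ inXs xs                        ≡⟨ sym (sum-support inXs xs uniq nonmember) ⟩
    sum inXs                            ≤⟨ sum-mono-≤ inXs≤matched ⟩
    sum (λ b → ⟦ isJust (mateB M b) ⟧)  ≡⟨ matchedB-count ⟩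
    + K                                 ∎)
    where
    open ℤP.≤-Reasoning
    inXs : Fin n → ℤ
    inXs b = ⟦ does (b ∈? xs) ⟧
    sumₗ-one : ∀ ys → sumₗ (λ _ → + 1) ys ≡ + length ys
    sumₗ-one []       = refl
    sumₗ-one (_ ∷ ys) = trans (cong (_+_ (+ 1)) (sumₗ-one ys)) (sym (ℤP.pos-+ 1 (length ys)))
    member : ∀ {b} → b ∈ xs → inXs b ≡ + 1
    member {b} b∈ with b ∈? xs
    ... | yes _  = refl
    ... | no  b∉ = ⊥-elim (b∉ b∈)
    nonmember : ∀ b → b ∉ xs → inXs b ≡ + 0
    nonmember b b∉ with b ∈? xs
    ... | yes b∈ = ⊥-elim (b∉ b∈)
    ... | no  _  = refl
    inXs≤matched : ∀ b → inXs b ≤ ⟦ isJust (mateB M b) ⟧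
    inXs≤matched b with b ∈? xs
    ... | yes b∈ rewrite lookup matched b∈ = ℤP.≤-refl
    ... | no  _  with isJust (mateB M b)
    ...   | true  = ℤ.+≤+ ℕ.z≤n
    ...   | false = ℤP.≤-refl

  linked-matched : ∀ {x y r} → Linked _⟵_ (x ∷ y ∷ r) → All (MatchedB G M) (x ∷ y ∷ r)
  linked-matched {r = []}    ((_ , My , _ , matched-x) ∷ [-])    = matched-x ∷ cong isJust My ∷ []
  linked-matched {r = _ ∷ _} ((_ , _ , _ , matched-x) ∷ linked) = matched-x ∷ linked-matched linked

  simple-length≤K : ∀ b r → Unique (b ∷ r) → Linked _⟵_ (b ∷ r) → length r ℕ.≤ K
  simple-length≤K b []      _    _      = ℕ.z≤n
  simple-length≤K b (y ∷ r) uniq linked = ℕP.≤-trans (ℕP.n≤1+n _) (unique-matched≤K (b ∷ y ∷ r) uniq (linked-matched linked))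

  walkWt≤length : ∀ x xs → walkWt (x ∷ xs) ≤ + length xs
  walkWt≤length x []       = ℤP.≤-refl
  walkWt≤length x (y ∷ ys) = subst (walkWt (x ∷ y ∷ ys) ≤_) (sym (ℤP.pos-+ 1 (length ys)))
    (ℤP.+-mono-≤ (arcWt≤1 y x) (walkWt≤length y ys))
    where
    arcWt≤1 : ∀ v u → arcWt v u ≤ + 1
    arcWt≤1 v u with mateB M v
    ... | just a  = halfWt≤1 a u
    ... | nothing = ℤ.+≤+ ℕ.z≤n

  matched⇒mate : ∀ {b} → MatchedB G M b → ∃ λ a → mateB M b ≡ just a
  matched⇒mate {b} matched with mateB M b
  ... | just a = a , refl

  simpleWalk≤K-1 : ∀ b r → Unique (b ∷ r) → Linked _⟵_ (b ∷ r) → walkValue (b ∷ r) ≤ + (K ∸ 1)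
  simpleWalk≤K-1 b [] _ _ = subst (_≤ + (K ∸ 1)) (sym (ℤP.+-identityˡ (startValue b))) (startValue≤K-1 b)
  simpleWalk≤K-1 b (y ∷ r) uniq linked@((_ , _ , _ , matched-b) ∷ _) = bound (nearFreeA? (lastOf y r))
    where
    open ℤP.≤-Reasoning
    Mb = proj₂ (matched⇒mate matched-b)
    bound : Dec (NearFreeA (lastOf y r)) → walkValue (b ∷ y ∷ r) ≤ + (K ∸ 1)
    bound (yes (_ , Ma , a-last)) = begin
      walkWt (b ∷ y ∷ r) + startValue (lastOf y r)
        ≤⟨ ℤP.+-mono-≤ (simpleWalkFromFreeA≤0 popularM Mb uniq linked Ma a-last) (startValue≤K-1 _) ⟩
      + 0 + + (K ∸ 1)  ≡⟨ ℤP.+-identityˡ _ ⟩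
      + (K ∸ 1)        ∎
    bound (no far) = begin
      walkWt (b ∷ y ∷ r) + startValue (lastOf y r)  ≡⟨ cong (_+_ (walkWt (b ∷ y ∷ r))) (startValue-far far) ⟩
      walkWt (b ∷ y ∷ r) + + 0                      ≡⟨ ℤP.+-identityʳ _ ⟩
      walkWt (b ∷ y ∷ r)                            ≤⟨ walkWt≤length b (y ∷ r) ⟩
      + length (y ∷ r)                              ≤⟨ ℤ.+≤+ (ℕP.∸-monoˡ-≤ 1 (unique-matched≤K (b ∷ y ∷ r) uniq (linked-matched linked))) ⟩
      + (K ∸ 1)                                     ∎

  simpleWalk≤0 : ∀ {b} r → PartnerNearFreeB b → Unique (b ∷ r) → Linked _⟵_ (b ∷ r) → walkValue (b ∷ r) ≤ + 0
  simpleWalk≤0 {b} r (_ , Mb , _ , Mu , a₀u) uniq linked = bound (nearFreeA? (lastOf b r))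
    where
    open ℤP.≤-Reasoning
    bound : Dec (NearFreeA (lastOf b r)) → walkValue (b ∷ r) ≤ + 0
    bound (yes (_ , Ma , a-last)) = ⊥-elim (no-augmenting-walk popularM Mb uniq linked Ma a-last Mu a₀u)
    bound (no far) = begin
      walkWt (b ∷ r) + startValue (lastOf b r)  ≡⟨ cong (_+_ (walkWt (b ∷ r))) (startValue-far far) ⟩
      walkWt (b ∷ r) + + 0                      ≡⟨ ℤP.+-identityʳ _ ⟩
      walkWt (b ∷ r)                            ≤⟨ simpleWalkToFreeB≤0 popularM Mb uniq linked Mu a₀u ⟩
      + 0                                       ∎

  _⟵?_ : ∀ u v → Dec (u ⟵ v)
  u ⟵? v with mateB M v
  ... | nothing = no λ { (_ , () , _) }
  ... | just a with E a u Bool.≟ true | isJust (mateB M u) Bool.≟ true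
  ...   | yes au  | yes mu  = yes (a , refl , au , mu)
  ...   | no  ¬au | _       = no λ { (_ , refl , au , _) → ¬au au }
  ...   | yes _   | no  ¬mu = no λ (_ , _ , _ , mu) → ¬mu mu

  candidate : (Fin n → ℤ) → Fin n → Fin n → Maybe ℤ
  candidate d b b' with b ⟵? b'
  ... | yes _ = just (d b' + arcWt b' b)
  ... | no  _ = nothing

  candidate-arc : ∀ d {b b'} → b ⟵ b' → candidate d b b' ≡ just (d b' + arcWt b' b)
  candidate-arc d {b} {b'} arc with b ⟵? b'
  ... | yes _    = refl
  ... | no  ¬arc = ⊥-elim (¬arc arc)

  candidate-sound : ∀ d {b b' v} → candidate d b b' ≡ just v → b ⟵ b' × d b' + arcWt b' b ≡ v
  candidate-sound d {b} {b'} eq with b ⟵? b'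
  candidate-sound d refl | yes arc = arc , refl

  -- Bellman–Ford: potential j b is the best value of a walk with at most j arcs ending at b.
  potential : ℕ → Fin n → ℤ
  potential ℕ.zero    b = startValue b
  potential (ℕ.suc j) b = maxOver (candidate (potential j) b) (potential j b)

  startValue≤potential : ∀ j b → startValue b ≤ potential j b
  startValue≤potential ℕ.zero    b = ℤP.≤-refl
  startValue≤potential (ℕ.suc j) b = ℤP.≤-trans (startValue≤potential j b) (≤maxOver (candidate (potential j) b) (potential j b))

  potential-attained : ∀ j b → ∃ λ r → Linked _⟵_ (b ∷ r) × length r ℕ.≤ j × walkValue (b ∷ r) ≡ potential j b
  potential-attained ℕ.zero    b = [] , [-] , ℕ.z≤n , ℤP.+-identityˡ (startValue b)
  potential-attained (ℕ.suc j) b with maxOver-attained (candidate (potential j) b) (potential j b)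
  ... | inj₁ max≡ = let r , linked , len≤ , value≡ = potential-attained j b in
    r , linked , ℕP.m≤n⇒m≤1+n len≤ , trans value≡ (sym max≡)
  ... | inj₂ (b' , candidate≡) = let arc , value≡ = candidate-sound (potential j) candidate≡
                                     r , linked , len≤ , value'≡ = potential-attained j b' in
    b' ∷ r , arc ∷ linked , ℕ.s≤s len≤ , (begin
      walkValue (b ∷ b' ∷ r)              ≡⟨ walkValue-∷ b b' r ⟩
      arcWt b' b + walkValue (b' ∷ r)     ≡⟨ cong (_+_ (arcWt b' b)) value'≡ ⟩
      arcWt b' b + potential j b'         ≡⟨ ℤP.+-comm (arcWt b' b) (potential j b') ⟩
      potential j b' + arcWt b' b         ≡⟨ value≡ ⟩
      potential (ℕ.suc j) b               ∎)
    where open ≡-Reasoning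

  walkValue≤potential : ∀ j b r → Linked _⟵_ (b ∷ r) → length r ℕ.≤ j → walkValue (b ∷ r) ≤ potential j b
  walkValue≤potential j b [] _ _ = subst (_≤ potential j b) (sym (ℤP.+-identityˡ (startValue b))) (startValue≤potential j b)
  walkValue≤potential (ℕ.suc j) b (y ∷ r) (arc ∷ linked) (ℕ.s≤s len≤) = begin
    walkValue (b ∷ y ∷ r)          ≡⟨ walkValue-∷ b y r ⟩
    arcWt y b + walkValue (y ∷ r)  ≤⟨ ℤP.+-monoʳ-≤ (arcWt y b) (walkValue≤potential j y r linked len≤) ⟩
    arcWt y b + potential j y      ≡⟨ ℤP.+-comm (arcWt y b) (potential j y) ⟩
    potential j y + arcWt y b      ≤⟨ candidate≤maxOver (candidate (potential j) b) (potential j b) (candidate-arc (potential j) arc) ⟩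
    potential (ℕ.suc j) b          ∎
    where open ℤP.≤-Reasoning

  simple-attained : ∀ j b → ∃ λ r → Linked _⟵_ (b ∷ r) × Unique (b ∷ r) × potential j b ≤ walkValue (b ∷ r)
  simple-attained j b with potential-attained j b
  ... | r , linked , _ , value≡ with simplify (length r) b r ℕP.≤-refl linked
  ...   | r' , linked' , uniq' , value≤ = r' , linked' , uniq' , subst (_≤ walkValue (b ∷ r')) value≡ value≤

  potential-stable : ∀ b → potential (ℕ.suc K) b ≤ potential K b
  potential-stable b with simple-attained (ℕ.suc K) b
  ... | r , linked , uniq , ≤value = ℤP.≤-trans ≤value (walkValue≤potential K b r linked (simple-length≤K b r uniq linked))

  potential≤K-1 : ∀ b → potential K b ≤ + (K ∸ 1)
  potential≤K-1 b with simple-attained K b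
  ... | r , linked , uniq , ≤value = ℤP.≤-trans ≤value (simpleWalk≤K-1 b r uniq linked)

  0≤potential : ∀ b → + 0 ≤ potential K b
  0≤potential b = ℤP.≤-trans (0≤startValue b) (startValue≤potential K b)

  potential-nearFreeA : ∀ {b} → NearFreeA b → potential K b ≡ + (K ∸ 1)
  potential-nearFreeA {b} near =
    ℤP.≤-antisym (potential≤K-1 b) (subst (_≤ potential K b) (startValue-nearFreeA near) (startValue≤potential K b))

  potential-partnerNearFreeB : ∀ {b} → PartnerNearFreeB b → potential K b ≡ + 0
  potential-partnerNearFreeB {b} partnerNear with simple-attained K b
  ... | r , linked , uniq , ≤value = ℤP.≤-antisym (ℤP.≤-trans ≤value (simpleWalk≤0 r partnerNear uniq linked)) (0≤potential b)

  potential-arc : ∀ {b b'} → b ⟵ b' → potential K b' + arcWt b' b ≤ potential K b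
  potential-arc {b} {b'} arc =
    ℤP.≤-trans (candidate≤maxOver (candidate (potential K) b) (potential K b) (candidate-arc (potential K) arc)) (potential-stable b)

module DualSolution {m n : ℕ} (G : PrefGraph m n) (M : Matching G) (popularM : IsPopularMaxMatching G M) where

  open PrefGraph G
  open MatchingFacts G M
  open Switching G M using (arcWt-≡)
  open Potential G M popularM
  open IntegerEmbedding
  open IntegerFacts using (r+r≤2y-2x)
  open MatchedSums ℚP.+-0-isCommutativeMonoid G M using (atMate; sum-matchedB)
  open ℚSum using (sum; ∑-distrib-+; sum-zero)
  open import Data.Fin using (zero; suc)
  open import Data.Bool using (if_then_else_)
  open import Data.Integer as ℤ using (ℤ; +_; ∣_∣)
  open import Data.Rational using (_+_; _≤_)
  open import Data.List using ([]; _∷_)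
  open import Data.List.Relation.Unary.AllPairs using ([]; _∷_)
  open import Data.List.Relation.Unary.All using ([]; _∷_)
  open import Relation.Binary.PropositionalEquality

  level : Fin n → ℕ
  level b = ∣ potential K b ∣

  +level : ∀ b → + level b ≡ potential K b
  +level b = ℤP.0≤i⇒+∣i∣≡i (0≤potential b)

  αB : Fin n → ℚ
  αB b = dbl G (level b)

  αA : Fin m → ℚ
  αA a = atMate (λ b → - αB b) (mateA M a)

  wt≤dual : ∀ {a b b'} → mateA M a ≡ just b' → E a b ≡ true → MatchedB G M b → wt G M a b ≤ - αB b' + αB b
  wt≤dual {a} {b} {b'} Ma ab matched-b = begin
    wt G M a b                                                  ≡⟨ wt≡toℚ-2·halfWt a b ⟩
    toℚ (halfWt a b ℤ.+ halfWt a b)                             ≤⟨ toℚ-mono-≤ (r+r≤2y-2x (level b') (level b) (halfWt a b) level-gap) ⟩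
    toℚ (ℤ.- + (2 ℕ.* level b') ℤ.+ + (2 ℕ.* level b))          ≡⟨ sym (toℚ-+ (ℤ.- + (2 ℕ.* level b')) (+ (2 ℕ.* level b))) ⟩
    toℚ (ℤ.- + (2 ℕ.* level b')) + αB b                         ≡⟨ cong (_+ αB b) (sym (toℚ-neg (+ (2 ℕ.* level b')))) ⟩
    - αB b' + αB b                                              ∎
    where
    open ℚP.≤-Reasoning
    Mb' : mateB M b' ≡ just a
    Mb' = consAB M a b' Ma
    level-gap : + level b' ℤ.+ halfWt a b ℤ.≤ + level b
    level-gap = subst₂ (λ p q → p ℤ.+ halfWt a b ℤ.≤ q) (sym (+level b')) (sym (+level b))
      (subst (λ w → potential K b' ℤ.+ w ℤ.≤ potential K b) (arcWt-≡ b Mb') (potential-arc (a , Mb' , ab , matched-b)))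

  feasible : Feasible G M αA αB
  feasible a b ab matched-a matched-b = at (mateA M a) refl matched-a
    where
    at : ∀ o → mateA M a ≡ o → isJust o ≡ true → wt G M a b ≤ αA a + αB b
    at (just b') Ma _ = subst (λ o → wt G M a b ≤ atMate (λ b → - αB b) o + αB b) (sym Ma) (wt≤dual Ma ab matched-b)

  sumℚ≡sum : ∀ {k} (f : Fin k → ℚ) → sumℚ f ≡ sum f
  sumℚ≡sum {ℕ.zero}  f = refl
  sumℚ≡sum {ℕ.suc k} f = cong (_+_ (f zero)) (sumℚ≡sum (f ∘ suc))

  sum-nonneg : ∀ {k} (f : Fin k → ℚ) → (∀ i → 0ℚ ≤ f i) → 0ℚ ≤ sum f
  sum-nonneg {ℕ.zero}  f _      = ℚP.≤-refl
  sum-nonneg {ℕ.suc k} f 0≤f = ℚP.+-mono-≤ (0≤f zero) (sum-nonneg (f ∘ suc) (0≤f ∘ suc))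

  pairValue : (Fin m → ℚ) → (Fin n → ℚ) → Fin m → ℚ
  pairValue yA yB a = (if isJust (mateA M a) then yA a else 0ℚ) + atMate yB (mateA M a)

  objective≡sum : ∀ yA yB → objective G M yA yB ≡ sum (pairValue yA yB)
  objective≡sum yA yB = begin
    objective G M yA yB
      ≡⟨ cong₂ _+_ (sumℚ≡sum ownA) (trans (sumℚ≡sum (λ b → if isJust (mateB M b) then yB b else 0ℚ)) (sum-matchedB yB)) ⟩
    sum ownA + sum (λ a → atMate yB (mateA M a))
      ≡⟨ sym (∑-distrib-+ ownA (λ a → atMate yB (mateA M a))) ⟩
    sum (pairValue yA yB) ∎
    where
    open ≡-Reasoning
    ownA : Fin m → ℚ
    ownA a = if isJust (mateA M a) then yA a else 0ℚ

  objective-α≡0 : objective G M αA αB ≡ 0ℚ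
  objective-α≡0 = trans (objective≡sum αA αB) (sum-zero (pairValue αA αB) pair≡0)
    where
    pair≡0 : ∀ a → pairValue αA αB a ≡ 0ℚ
    pair≡0 a with mateA M a
    ... | just b  = ℚP.+-inverseˡ (αB b)
    ... | nothing = ℚP.+-identityˡ 0ℚ

  objective-nonneg : ∀ zA zB → Feasible G M zA zB → 0ℚ ≤ objective G M zA zB
  objective-nonneg zA zB feasible-z = subst (0ℚ ≤_) (sym (objective≡sum zA zB)) (sum-nonneg (pairValue zA zB) pair≥0)
    where
    pair≥0 : ∀ a → 0ℚ ≤ pairValue zA zB a
    pair≥0 a with mateA M a in Ma
    ... | just b  = subst (_≤ zA a + zB b) wt-mate≡0
                      (feasible-z a b (inE M a b Ma) (cong isJust Ma) (cong isJust (consAB M a b Ma)))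
      where
      wt-mate≡0 : wt G M a b ≡ 0ℚ
      wt-mate≡0 = trans (wt≡toℚ-2·halfWt a b) (cong (λ h → toℚ (h ℤ.+ h)) (halfWt-mate Ma))
    ... | nothing = ℚP.≤-refl

  optimal : Optimal G M αA αB
  optimal = feasible , λ zA zB feasible-z → subst (_≤ objective G M zA zB) (sym objective-α≡0) (objective-nonneg zA zB feasible-z)

  level<K : ∀ {b} → MatchedB G M b → level b ℕ.< K
  level<K {b} matched-b = below (ℤP.drop‿+≤+ (subst (ℤ._≤ + (K ∸ 1)) (sym (+level b)) (potential≤K-1 b)))
                                (unique-matched≤K (b ∷ []) ([] ∷ []) (matched-b ∷ []))
    where
    below : ∀ {k N} → k ℕ.≤ N ∸ 1 → 1 ℕ.≤ N → k ℕ.< N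
    below {N = ℕ.suc N} k≤ _ = ℕ.s≤s k≤

  αA-range : ∀ a → MatchedA G M a → ∃ λ k → k < n₀ G M × αA a ≡ - dbl G k
  αA-range a matched-a with mateA M a in Ma
  αA-range a matched-a | just b' = level b' , level<K (cong isJust (consAB M a b' Ma)) , refl
  αA-range a ()        | nothing

  αB-range : ∀ b → MatchedB G M b → ∃ λ k → k < n₀ G M × αB b ≡ dbl G k
  αB-range b matched-b = level b , level<K matched-b , refl

  αA-nbr-freeB : ∀ a b → E a b ≡ true → MatchedA G M a → mateB M b ≡ nothing → αA a ≡ 0ℚ
  αA-nbr-freeB a b ab matched-a Mb with mateA M a in Ma
  αA-nbr-freeB a b ab matched-a Mb | just b' =
    cong (λ k → - dbl G k) (ℤP.+-injective (trans (+level b') (potential-partnerNearFreeB (a , consAB M a b' Ma , b , Mb , ab))))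
  αA-nbr-freeB a b ab ()        Mb | nothing

  αB-nbr-freeA : ∀ b a → E a b ≡ true → MatchedB G M b → mateA M a ≡ nothing → αB b ≡ dbl G (n₀ G M ∸ 1)
  αB-nbr-freeA b a ab _ Ma = cong (dbl G) (ℤP.+-injective (trans (+level b) (potential-nearFreeA (a , Ma , ab))))

theorem5 : ∀ {m n : ℕ} (G : PrefGraph m n) (M : Matching G) →
  IsPopularMaxMatching G M →
  Σ (Fin m → ℚ) λ αA → Σ (Fin n → ℚ) λ αB →
    Optimal G M αA αB
    × (∀ a → MatchedA G M a → ∃ λ k → k < n₀ G M × αA a ≡ - dbl G k)
    × (∀ b → MatchedB G M b → ∃ λ k → k < n₀ G M × αB b ≡ dbl G k)
    × (∀ a b → PrefGraph.E G a b ≡ true → MatchedA G M a →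
         mateB M b ≡ nothing → αA a ≡ 0ℚ)
    × (∀ b a → PrefGraph.E G a b ≡ true → MatchedB G M b →
         mateA M a ≡ nothing → αB b ≡ dbl G (n₀ G M ∸ 1))
theorem5 G M popularM = αA , αB , optimal , αA-range , αB-range , αA-nbr-freeB , αB-nbr-freeA
  where open DualSolution G M popularM
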